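{- For every stack partition $\tau\Vdash n$, \[ P_\tau = \sum_{\alpha\Vdash n}\mathcal{D}_{\tau,\alpha}\, M_\alpha . \]
   Context: Polysymmetric functions are formal power series of bounded degree in variables $x_{i,j}$ ($i,j\ge1$), $x_{i,j}$ of degree $i$, invariant under permutations of $x_{i,1},x_{i,2},\dots$ for each fixed $i$. A stack is a pair of positive integers $d^m$; a stack partition $\tau\Vdash n$ is a finite weakly decreasing sequence of stacks $(d_1^{m_1},\dots,d_s^{m_s})$ (ordered by $d^m\ge d'^{m'}$ iff $d>d'$, or $d=d'$ and $m\ge m'$) with $\sum d_im_i=n$. $M_\tau=\sum_\alpha x_{d_1,\alpha_1}^{m_1}\cdots x_{d_s,\alpha_s}^{m_s}$ over sequences $\alpha$ of positive integers with $\alpha_i\ne\alpha_j$ whenever $d_i=d_j$, $i\ne j$. $P_d=\sum_{k\mid d}kM_{k^{d/k}}$; $P_{d^m}$ is $P_d$ with each $x_{i,j}$ replaced by $x_{i,j}^m$; $P_\tau=\prod_iP_{d_i^{m_i}}$. For $u\ge1$, $\tau|_u$ is the weakly decreasing sequence of multiplicities of the degree-$u$ stacks of $\tau$. For a sequence $\boldsymbol\beta=(\beta_1,\dots,\beta_r)$ of stack partitions and a stack partition $\alpha$, let $s^\alpha_{\boldsymbol\beta}(u)$ be the number of $r\times\ell(\alpha|_u)$ nonnegative integer matrices whose $i$th row is a rearrangement of $\beta_i|_u$ padded with zeros to length $\ell(\alpha|_u)$ and whose column sums equal $\alpha|_u$ ($0$ if some $\ell(\beta_i|_u)>\ell(\alpha|_u)$;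 $1$ if all are empty), and $\mathcal S^\alpha_{\boldsymbol\beta}=\prod_{u\ge1}s^\alpha_{\boldsymbol\beta}(u)$. For $\tau=(d_1^{m_1},\dots,d_s^{m_s})$, a stack divisor $k=(k_1,\dots,k_s)\mid\tau$ is a tuple of positive integers with $k_i\mid d_i$ for all $i$, and $D(\tau,k)$ is the sequence of one-stack stack partitions $\big((k_1^{d_1m_1/k_1}),\dots,(k_s^{d_sm_s/k_s})\big)$. Define $\mathcal D_{\tau,\alpha}=\sum_{k\mid\tau}\big(\prod_{i=1}^sk_i\big)\mathcal S^\alpha_{D(\tau,k)}$. -}

module Defs where

open import Data.Bool using (Bool; true; false; not; if_then_else_; _∧_; _∨_; T)
open import Data.Nat using (ℕ; zero; suc; _+_; _*_; _∸_; _≡ᵇ_; _<ᵇ_; _/_; _%_)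
open import Data.Product using (_×_; _,_; proj₁; proj₂)
open import Data.Nat.ListAction using (sum; product)
open import Data.Bool.ListAction using (and; or)
open import Data.List using (List; []; _∷_; _++_; map; upTo; drop;
  length; replicate; filterᵇ; concatMap; zipWith; foldr; zip)
open import Relation.Binary.PropositionalEquality using (_≡_)

all : {A : Set} → (A → Bool) → List A → Bool
all p xs = and (map p xs)

any : {A : Set} → (A → Bool) → List A → Bool
any p xs = or (map p xs)

from1 : ℕ → List ℕ
from1 B = drop 1 (upTo B)

count : {A : Set} → (A → Bool) → List A → ℕ
count p xs = length (filterᵇ p xs)

choices : {A : Set} → List (List A) → List (List A)
choices []       = [] ∷ []
choices (c ∷ cs) = concatMap (λ x → map (x ∷_) (choices cs)) c

eqListᵇ : List ℕ → List ℕ → Bool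
eqListᵇ []       []       = true
eqListᵇ (x ∷ xs) (y ∷ ys) = (x ≡ᵇ y) ∧ eqListᵇ xs ys
eqListᵇ _        _        = false

occ : ℕ → List ℕ → ℕ
occ v xs = count (λ x → x ≡ᵇ v) xs

isPermᵇ : List ℕ → List ℕ → Bool
isPermᵇ xs ys = all (λ v → occ v xs ≡ᵇ occ v ys) (xs ++ ys)

-- a stack d^m is the pair (d , m)
Stack : Set
Stack = ℕ × ℕ

deg : Stack → ℕ
deg = proj₁

mult : Stack → ℕ
mult = proj₂

stack≥ᵇ : Stack → Stack → Bool
stack≥ᵇ (d , m) (d' , m') = (d' <ᵇ d) ∨ ((d ≡ᵇ d') ∧ (m' <ᵇ suc m))

weaklyDecᵇ : List Stack → Bool
weaklyDecᵇ []           = true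
weaklyDecᵇ (_ ∷ [])     = true
weaklyDecᵇ (s ∷ t ∷ ss) = stack≥ᵇ s t ∧ weaklyDecᵇ (t ∷ ss)

positiveᵇ : Stack → Bool
positiveᵇ (d , m) = (0 <ᵇ d) ∧ (0 <ᵇ m)

size : List Stack → ℕ
size τ = sum (map (λ s → deg s * mult s) τ)

isStackPartitionᵇ : ℕ → List Stack → Bool
isStackPartitionᵇ n τ = all positiveᵇ τ ∧ weaklyDecᵇ τ ∧ (size τ ≡ᵇ n)

_⊩_ : List Stack → ℕ → Set
τ ⊩ n = T (isStackPartitionᵇ n τ)

-- the finite list of all stack partitions of n (each exactly once):
-- sequences of length ℓ ≤ n of stacks d^m with 1 ≤ d, m ≤ n, filtered
stackPartitions : ℕ → List (List Stack)
stackPartitions n =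
  filterᵇ (isStackPartitionᵇ n)
    (concatMap (λ ℓ → choices (replicate ℓ stacks)) (upTo (suc n)))
  where
  stacks : List Stack
  stacks = concatMap (λ d → map (λ m → (d , m)) (from1 (suc n))) (from1 (suc n))

-- A monomial is given by a bound B and raw exponents; its exponent of
-- x_{i,j} is raw i j when 1 ≤ i < B and 1 ≤ j < B, and 0 otherwise.
-- (Every monomial in finitely many of the variables arises this way.)
record Mono : Set where
  constructor mono
  field
    bound : ℕ
    raw   : ℕ → ℕ → ℕ

inRangeᵇ : ℕ → ℕ → ℕ → Bool
inRangeᵇ B i j = (0 <ᵇ i) ∧ (i <ᵇ B) ∧ (0 <ᵇ j) ∧ (j <ᵇ B)

expo : Mono → ℕ → ℕ → ℕ
expo (mono B r) i j = if inRangeᵇ B i j then r i j else 0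

positions : ℕ → List (ℕ × ℕ)
positions B = concatMap (λ i → map (λ j → (i , j)) (from1 B)) (from1 B)

-- A formal power series (with ℕ coefficients) is its coefficient function.
Series : Set
Series = Mono → ℕ

_≈_ : Series → Series → Set
f ≈ g = ∀ μ → f μ ≡ g μ

zeroS : Series
zeroS _ = 0

oneS : Series
oneS μ = if all (λ ij → expo μ (proj₁ ij) (proj₂ ij) ≡ᵇ 0) (positions (Mono.bound μ))
         then 1 else 0

_⊕_ : Series → Series → Series
(f ⊕ g) μ = f μ + g μ

scale : ℕ → Series → Series
scale c f μ = c * f μ

sumS : List Series → Series
sumS = foldr _⊕_ zeroS

setAt : (ℕ → ℕ → ℕ) → ℕ → ℕ → ℕ → (ℕ → ℕ → ℕ)
setAt f i j a i' j' = if (i' ≡ᵇ i) ∧ (j' ≡ᵇ j) then a else f i' j'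

below : List (ℕ × ℕ) → (ℕ → ℕ → ℕ) → List (ℕ → ℕ → ℕ)
below []              e = (λ _ _ → 0) ∷ []
below ((i , j) ∷ ps)  e =
  concatMap (λ f → map (λ a → setAt f i j a) (upTo (suc (e i j)))) (below ps e)

_⊛_ : Series → Series → Series
(f ⊛ g) μ = sum (map (λ ν → f (mono B ν) * g (mono B (λ i j → expo μ i j ∸ ν i j)))
                     (below (positions B) (expo μ)))
  where B = Mono.bound μ

prodS : List Series → Series
prodS = foldr _⊛_ oneS

-- substitution x_{i,j} ↦ x_{i,j}^m  (m ≥ 1):
-- coefficient of x^μ is f_{μ/m} if m divides every exponent of μ, else 0
powSubst : ℕ → Series → Series
powSubst zero    f = f   -- never used: multiplicities of stacks are ≥ 1
powSubst (suc k) f μ =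
  if all (λ ij → (expo μ (proj₁ ij) (proj₂ ij) % suc k) ≡ᵇ 0) (positions B)
  then f (mono B (λ i j → expo μ i j / suc k)) else 0
  where B = Mono.bound μ

-- a monomial presented as a list of factors x_{i,j}^m, written ((i , j) , m)
Term : Set
Term = List ((ℕ × ℕ) × ℕ)

termExp : Term → ℕ → ℕ → ℕ
termExp t i j = sum (map (λ v → if (proj₁ (proj₁ v) ≡ᵇ i) ∧ (proj₂ (proj₁ v) ≡ᵇ j)
                                then proj₂ v else 0) t)

matchesᵇ : Mono → Term → Bool
matchesᵇ μ t =
  all (λ v → inRangeᵇ B (proj₁ (proj₁ v)) (proj₂ (proj₁ v))) t
  ∧ all (λ ij → expo μ (proj₁ ij) (proj₂ ij) ≡ᵇ termExp t (proj₁ ij) (proj₂ ij))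
        (positions B)
  where B = Mono.bound μ

-- α_i ≠ α_j whenever d_i = d_j (i ≠ j); entries are pairs (d_i , α_i)
distinctPerDegᵇ : List (ℕ × ℕ) → Bool
distinctPerDegᵇ []             = true
distinctPerDegᵇ ((d , a) ∷ xs) =
  all (λ y → not ((d ≡ᵇ proj₁ y) ∧ (a ≡ᵇ proj₂ y))) xs ∧ distinctPerDegᵇ xs

-- M_τ = Σ x_{d_1,α_1}^{m_1} ⋯ x_{d_s,α_s}^{m_s}, α_i ≠ α_j whenever
-- d_i = d_j, read (as for monomial symmetric functions) as the sum of the
-- DISTINCT monomials of this form, each with coefficient 1.  So the
-- coefficient of x^μ is 1 if some admissible α gives x^μ and 0 otherwise.
-- Since every m_i ≥ 1, a term can equal x^μ only if every α_i lies in
-- [1, B) (B = bound of μ), so searching over those α is exact.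
M : List Stack → Series
M τ μ = if any (λ α → distinctPerDegᵇ (zip (map deg τ) α)
                      ∧ matchesᵇ μ (zipWith (λ s a → ((deg s , a) , mult s)) τ α))
               (choices (replicate (length τ) (from1 (Mono.bound μ))))
        then 1 else 0

divisorPairs : ℕ → List (ℕ × ℕ)
divisorPairs d = map (λ k' → (suc k' , d / suc k'))
                     (filterᵇ (λ k' → (d % suc k') ≡ᵇ 0) (upTo d))

P₁ : ℕ → Series
P₁ d = sumS (map (λ kq → scale (proj₁ kq) (M ((proj₁ kq , proj₂ kq) ∷ [])))
                 (divisorPairs d))

Pstack : Stack → Series
Pstack (d , m) = powSubst m (P₁ d)

P : List Stack → Series
P τ = prodS (map Pstack τ)

restrict : List Stack → ℕ → List ℕ
restrict τ u = map mult (filterᵇ (λ s → deg s ≡ᵇ u) τ)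

colSums : ℕ → List (List ℕ) → List ℕ
colSums L rows = foldr (zipWith _+_) (replicate L 0) rows

-- s^α_β(u): number of r × ℓ(α|_u) matrices of naturals whose i-th row is a
-- rearrangement of β_i|_u padded by zeros to length ℓ(α|_u), with column
-- sums α|_u.  (Rows are enumerated as length-L lists with entries ≤ the row
-- sum, which contains every rearrangement.)
sCount : List Stack → List (List Stack) → ℕ → ℕ
sCount α βs u = count (λ rows → eqListᵇ (colSums L rows) αu)
                      (choices (map rowCands βs))
  where
  αu = restrict α u
  L  = length αu
  rowCands : List Stack → List (List ℕ)
  rowCands β = filterᵇ (λ r → isPermᵇ r (βu ++ replicate (L ∸ length βu) 0))
                       (choices (replicate L (upTo (suc (sum βu)))))
    where βu = restrict β u

-- 𝒮^α_β = Π_{u ≥ 1} s^α_β(u); factors with u larger than every degree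
-- occurring are 1 (all restrictions empty), so the product is over
-- 1 ≤ u ≤ N with N the total of all degrees occurring.
𝒮 : List Stack → List (List Stack) → ℕ
𝒮 α βs = product (map (sCount α βs) (from1 (suc N)))
  where
  N = sum (map deg α) + sum (map (λ β → sum (map deg β)) βs)

-- D(τ,k) = ((k_1^{d_1 m_1/k_1}), …, (k_s^{d_s m_s/k_s})), with k given as
-- the list of pairs (k_i , d_i / k_i)
Dseq : List Stack → List (ℕ × ℕ) → List (List Stack)
Dseq τ ks = zipWith (λ s kq → ((proj₁ kq , proj₂ kq * mult s) ∷ [])) τ ks

𝒟 : List Stack → List Stack → ℕ
𝒟 τ α = sum (map (λ ks → product (map proj₁ ks) * 𝒮 α (Dseq τ ks))
                 (choices (map (λ s → divisorPairs (deg s)) τ)))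

-- Compare the coefficients of a monomial x^r.  Expanding P_τ = Π P_{d_i^{m_i}} with
-- P_d = Σ_{k ∣ d} k M_{k^{d/k}}, the coefficient of x^r in P_τ is Σ_{k ∣ τ} (Π k_i) F_k(r), where
-- F_k(r) counts the ways to write x^r = Π_i x_{k_i,j_i}^{d_i m_i / k_i}.  Such a factorization
-- sends the i-th one-stack row of D(τ,k) to one of the variables of degree k_i occurring in x^r,
-- i.e. to a column of the matrices counted by 𝒮^α_{D(τ,k)}, where α, the shape of x^r, lists its
-- exponents as sorted stacks; hence F_k(r) = 𝒮^α_{D(τ,k)} and the coefficient is 𝒟_{τ,α}.  On the
-- right-hand side x^r occurs in M_β exactly for β = α, and if x^r does not have degree n there is
-- no factorization at all, so both sides vanish.

module Submission where

open import Defs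
open import Data.Bool using (Bool; true; false; not; if_then_else_; _∧_; _∨_; T)
open import Algebra.Bundles using (CommutativeMonoid)
import Algebra.Properties.CommutativeSemigroup
open import Data.Bool.Properties using (∧-zeroʳ; ∧-identityʳ; ∨-zeroʳ; ∧-commutativeMonoid)
open import Data.Empty using (⊥-elim)
open import Function using (_∘_; mk⇔)
open import Data.List using (List; []; _∷_; _++_; map; concatMap; filterᵇ; length; replicate;
  zipWith; zip; upTo; cartesianProduct)
open import Data.List.Membership.Propositional using (_∈_; find)
open import Data.List.Membership.Propositional.Properties.WithK using (unique∧set⇒bag)
open import Data.List.Membership.Propositional.Properties using (∈-upTo⁺; ∈-upTo⁻;
  ∈-applyUpTo⁺; ∈-applyUpTo⁻; ∈-cartesianProduct⁺; ∈-cartesianProduct⁻; ∈-map⁺; ∈-map⁻;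
  ∈-concatMap⁻; ∈-++⁺ˡ; ∈-++⁺ʳ)
open import Data.List.Properties using (length-map; length-replicate; map-cong)
open import Data.List.Relation.Binary.BagAndSetEquality using (∼bag⇒↭)
open import Data.List.Relation.Binary.Permutation.Propositional as ↭ using (_↭_; ↭-sym; ↭-trans)
import Data.List.Relation.Binary.Permutation.Propositional.Properties as ↭
import Data.List.Relation.Binary.Permutation.Setoid.Properties
open import Data.List.Relation.Unary.All as All using (All; []; _∷_)
import Data.List.Relation.Unary.All.Properties as All
open import Data.List.Relation.Unary.AllPairs using ([]; _∷_)
open import Data.List.Relation.Unary.Any as Any using (Any; here; there)
open import Data.List.Relation.Unary.Unique.Propositional using (Unique)
import Data.List.Relation.Unary.Unique.Propositional.Properties as Unique
open import Data.Nat using (ℕ; zero; suc; >-nonZero; _+_; _*_; _∸_; _≤_; _<_; _≡ᵇ_; _<ᵇ_; _/_; _%_; z≤n; s≤s; _≟_; _<?_; _≤?_)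
open import Data.List.Membership.DecPropositional _≟_ using (_∈?_)
open import Data.Nat.DivMod using (m≡m%n+[m/n]*n; m*n%n≡0; m*n/n≡m)
open import Data.Nat.ListAction using (sum; product)
open import Data.Nat.ListAction.Properties using (sum-↭)
open import Data.Nat.Properties
open import Data.Product using (_×_; _,_; proj₁; proj₂; ∃; map₁)
open import Data.Product.Properties using (≡-dec)
open import Data.Sum using (_⊎_; inj₁; inj₂)
open import Relation.Nullary using (¬_; yes; no)
open import Relation.Binary.Definitions using (tri<; tri≈; tri>)
open import Relation.Binary.PropositionalEquality

private
  variable
    A B′ : Set

  module +-CS = Algebra.Properties.CommutativeSemigroup +-commutativeSemigroup
  module *-CS = Algebra.Properties.CommutativeSemigroup *-commutativeSemigroup
  module ∧-CS = Algebra.Properties.CommutativeSemigroup (CommutativeMonoid.commutativeSemigroup ∧-commutativeMonoid)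

∑ : List A → (A → ℕ) → ℕ
∑ xs f = sum (map f xs)

𝟙 : Bool → ℕ
𝟙 b = if b then 1 else 0

∑-++ : (xs ys : List A) (f : A → ℕ) → ∑ (xs ++ ys) f ≡ ∑ xs f + ∑ ys f
∑-++ []       ys f = refl
∑-++ (x ∷ xs) ys f = trans (cong (f x +_) (∑-++ xs ys f)) (sym (+-assoc (f x) _ _))

∑-cong : {f g : A → ℕ} → (∀ x → f x ≡ g x) → (xs : List A) → ∑ xs f ≡ ∑ xs g
∑-cong h []       = refl
∑-cong h (x ∷ xs) = cong₂ _+_ (h x) (∑-cong h xs)

∑-cong-∈ : {f g : A → ℕ} {xs : List A} → (∀ {x} → x ∈ xs → f x ≡ g x) → ∑ xs f ≡ ∑ xs g
∑-cong-∈ {xs = []}     h = refl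
∑-cong-∈ {xs = x ∷ xs} h = cong₂ _+_ (h (here refl)) (∑-cong-∈ (h ∘ there))

∑-map : (g : A → B′) (xs : List A) (f : B′ → ℕ) → ∑ (map g xs) f ≡ ∑ xs (λ x → f (g x))
∑-map g []       f = refl
∑-map g (x ∷ xs) f = cong (f (g x) +_) (∑-map g xs f)

∑-concatMap : (g : A → List B′) (xs : List A) (f : B′ → ℕ) →
  ∑ (concatMap g xs) f ≡ ∑ xs (λ x → ∑ (g x) f)
∑-concatMap g []       f = refl
∑-concatMap g (x ∷ xs) f =
  trans (∑-++ (g x) (concatMap g xs) f) (cong (∑ (g x) f +_) (∑-concatMap g xs f))

∑-+ : (xs : List A) (f g : A → ℕ) → ∑ xs (λ x → f x + g x) ≡ ∑ xs f + ∑ xs g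
∑-+ []       f g = refl
∑-+ (x ∷ xs) f g = trans (cong (f x + g x +_) (∑-+ xs f g)) (+-CS.interchange (f x) (g x) _ _)

∑-*ˡ : (c : ℕ) (xs : List A) (f : A → ℕ) → ∑ xs (λ x → c * f x) ≡ c * ∑ xs f
∑-*ˡ c []       f = sym (*-zeroʳ c)
∑-*ˡ c (x ∷ xs) f = trans (cong (c * f x +_) (∑-*ˡ c xs f)) (sym (*-distribˡ-+ c (f x) _))

∑-*ʳ : (c : ℕ) (xs : List A) (f : A → ℕ) → ∑ xs (λ x → f x * c) ≡ ∑ xs f * c
∑-*ʳ c []       f = refl
∑-*ʳ c (x ∷ xs) f = trans (cong (f x * c +_) (∑-*ʳ c xs f)) (sym (*-distribʳ-+ c (f x) _))

∑-zero : {f : A → ℕ} → (∀ x → f x ≡ 0) → (xs : List A) → ∑ xs f ≡ 0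
∑-zero h []       = refl
∑-zero h (x ∷ xs) = cong₂ _+_ (h x) (∑-zero h xs)

∑-zero-∈ : {f : A → ℕ} {xs : List A} → (∀ {x} → x ∈ xs → f x ≡ 0) → ∑ xs f ≡ 0
∑-zero-∈ {xs = []}     h = refl
∑-zero-∈ {xs = x ∷ xs} h = cong₂ _+_ (h (here refl)) (∑-zero-∈ (h ∘ there))

∑-comm : (xs : List A) (ys : List B′) (F : A → B′ → ℕ) →
  ∑ xs (λ x → ∑ ys (F x)) ≡ ∑ ys (λ y → ∑ xs (λ x → F x y))
∑-comm []       ys F = sym (∑-zero (λ _ → refl) ys)
∑-comm (x ∷ xs) ys F =
  trans (cong (∑ ys (F x) +_) (∑-comm xs ys F)) (sym (∑-+ ys (F x) (λ y → ∑ xs (λ x → F x y))))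

∑-filter : (p : A → Bool) (xs : List A) (f : A → ℕ) → ∑ (filterᵇ p xs) f ≡ ∑ xs (λ x → 𝟙 (p x) * f x)
∑-filter p []       f = refl
∑-filter p (x ∷ xs) f with p x
... | true  = cong₂ _+_ (sym (+-identityʳ (f x))) (∑-filter p xs f)
... | false = ∑-filter p xs f

count≡∑𝟙 : (p : A → Bool) (xs : List A) → count p xs ≡ ∑ xs (λ x → 𝟙 (p x))
count≡∑𝟙 p []       = refl
count≡∑𝟙 p (x ∷ xs) with p x
... | true  = cong suc (count≡∑𝟙 p xs)
... | false = count≡∑𝟙 p xs

∑-choices : (c : List A) (cs : List (List A)) (f : List A → ℕ) →
  ∑ (choices (c ∷ cs)) f ≡ ∑ c (λ x → ∑ (choices cs) (λ ys → f (x ∷ ys)))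
∑-choices c cs f = trans (∑-concatMap (λ x → map (x ∷_) (choices cs)) c f)
                         (∑-cong (λ x → ∑-map (x ∷_) (choices cs) f) c)

∑≢0⇒∃ : (xs : List A) (f : A → ℕ) → ∑ xs f ≢ 0 → ∃ λ x → x ∈ xs × f x ≢ 0
∑≢0⇒∃ []       f h = ⊥-elim (h refl)
∑≢0⇒∃ (x ∷ xs) f h with f x ≟ 0
... | no fx≢0 = x , here refl , fx≢0
... | yes fx≡0 with ∑≢0⇒∃ xs f (λ e → h (cong₂ _+_ fx≡0 e))
...   | y , y∈xs , fy≢0 = y , there y∈xs , fy≢0

≡true⇒T : {b : Bool} → b ≡ true → T b
≡true⇒T refl = _

T⇒≡true : {b : Bool} → T b → b ≡ true
T⇒≡true {true} _ = refl

∧-true⁻ : {a b : Bool} → (a ∧ b) ≡ true → a ≡ true × b ≡ true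
∧-true⁻ {true} {true} _ = refl , refl

∨-true⁻ : {a b : Bool} → (a ∨ b) ≡ true → a ≡ true ⊎ b ≡ true
∨-true⁻ {true}  _ = inj₁ refl
∨-true⁻ {false} h = inj₂ h

∧-≡false : ∀ a {b} → (a ≡ true → b ≡ false) → (a ∧ b) ≡ false
∧-≡false true  h = h refl
∧-≡false false h = refl

false≢true : false ≢ true
false≢true ()

≡ᵇ-refl : ∀ m → (m ≡ᵇ m) ≡ true
≡ᵇ-refl zero    = refl
≡ᵇ-refl (suc m) = ≡ᵇ-refl m

≡ᵇ-sound : ∀ {m n} → (m ≡ᵇ n) ≡ true → m ≡ n
≡ᵇ-sound {m} {n} e = ≡ᵇ⇒≡ m n (≡true⇒T e)

≡ᵇ-false : ∀ {m n} → m ≢ n → (m ≡ᵇ n) ≡ false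
≡ᵇ-false {m} {n} m≢n with m ≡ᵇ n in e
... | true  = ⊥-elim (m≢n (≡ᵇ-sound e))
... | false = refl

≡ᵇ-sym : ∀ m n → (m ≡ᵇ n) ≡ (n ≡ᵇ m)
≡ᵇ-sym zero    zero    = refl
≡ᵇ-sym zero    (suc n) = refl
≡ᵇ-sym (suc m) zero    = refl
≡ᵇ-sym (suc m) (suc n) = ≡ᵇ-sym m n

<ᵇ-true : ∀ {m n} → m < n → (m <ᵇ n) ≡ true
<ᵇ-true m<n = T⇒≡true (<⇒<ᵇ m<n)

<ᵇ-sound : ∀ {m n} → (m <ᵇ n) ≡ true → m < n
<ᵇ-sound {m} {n} e = <ᵇ⇒< m n (≡true⇒T e)

<ᵇ-false : ∀ {m n} → ¬ m < n → (m <ᵇ n) ≡ false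
<ᵇ-false {m} {n} m≮n with m <ᵇ n in e
... | true  = ⊥-elim (m≮n (<ᵇ-sound e))
... | false = refl

all-true⁻ : {p : A → Bool} (xs : List A) → all p xs ≡ true → All (λ x → p x ≡ true) xs
all-true⁻         []       _ = []
all-true⁻ {p = p} (x ∷ xs) h with p x in e
... | true = e ∷ all-true⁻ xs h

all-true⁺ : {p : A → Bool} {xs : List A} → All (λ x → p x ≡ true) xs → all p xs ≡ true
all-true⁺ []       = refl
all-true⁺ (h ∷ hs) rewrite h = all-true⁺ hs

all-false⁻ : {p : A → Bool} (xs : List A) → all p xs ≡ false → Any (λ x → p x ≡ false) xs
all-false⁻ {p = p} (x ∷ xs) h with p x in e
... | true  = there (all-false⁻ xs h)
... | false = here e

all-false⁺ : {p : A → Bool} {xs : List A} {x : A} → x ∈ xs → p x ≡ false → all p xs ≡ false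
all-false⁺ {p = p} {y ∷ xs} (here refl) px rewrite px = refl
all-false⁺ {p = p} {y ∷ xs} (there x∈xs) px = trans (cong (p y ∧_) (all-false⁺ x∈xs px)) (∧-zeroʳ (p y))

any-true⁻ : {p : A → Bool} (xs : List A) → any p xs ≡ true → Any (λ x → p x ≡ true) xs
any-true⁻ {p = p} (x ∷ xs) h with p x in e
... | true  = here e
... | false = there (any-true⁻ xs h)

any-true⁺ : {p : A → Bool} {xs : List A} {x : A} → x ∈ xs → p x ≡ true → any p xs ≡ true
any-true⁺ {p = p} {y ∷ xs} (here refl) px rewrite px = refl
any-true⁺ {p = p} {y ∷ xs} (there x∈xs) px = trans (cong (p y ∨_) (any-true⁺ x∈xs px)) (∨-zeroʳ (p y))

all-cong-∈ : {p q : A → Bool} {xs : List A} → (∀ {x} → x ∈ xs → p x ≡ q x) → all p xs ≡ all q xs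
all-cong-∈ {xs = []}     h = refl
all-cong-∈ {xs = x ∷ xs} h = cong₂ _∧_ (h (here refl)) (all-cong-∈ (h ∘ there))

all-cong : {p q : A → Bool} → (∀ x → p x ≡ q x) → (xs : List A) → all p xs ≡ all q xs
all-cong h xs = all-cong-∈ {xs = xs} (λ {x} _ → h x)

any-cong : {p q : A → Bool} → (∀ x → p x ≡ q x) → (xs : List A) → any p xs ≡ any q xs
any-cong h []       = refl
any-cong h (x ∷ xs) = cong₂ _∨_ (h x) (any-cong h xs)

all-∧ : (p q : A → Bool) (xs : List A) → all (λ x → p x ∧ q x) xs ≡ all p xs ∧ all q xs
all-∧ p q []       = refl
all-∧ p q (x ∷ xs) rewrite all-∧ p q xs with p x | q x
... | true  | true  = refl
... | true  | false = sym (∧-zeroʳ (all p xs))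
... | false | _     = refl

any-map : (p : B′ → Bool) (f : A → B′) (xs : List A) → any p (map f xs) ≡ any (p ∘ f) xs
any-map p f []       = refl
any-map p f (x ∷ xs) = cong (p (f x) ∨_) (any-map p f xs)

+≡ᵇ-split : ∀ a x b → (a + x ≡ᵇ b) ≡ ((a <ᵇ suc b) ∧ (x ≡ᵇ b ∸ a))
+≡ᵇ-split a x b with a ≤? b
... | yes a≤b rewrite <ᵇ-true (s≤s a≤b) with x ≟ b ∸ a
...   | yes refl rewrite m+[n∸m]≡n a≤b | ≡ᵇ-refl b | ≡ᵇ-refl (b ∸ a) = refl
...   | no x≢b∸a rewrite ≡ᵇ-false x≢b∸a = ≡ᵇ-false (λ e → x≢b∸a (sym (trans (cong (_∸ a) (sym e)) (m+n∸m≡n a x))))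
+≡ᵇ-split a x b | no a≰b rewrite <ᵇ-false {a} {suc b} (a≰b ∘ ≤-pred) =
  ≡ᵇ-false (λ e → a≰b (subst (a ≤_) e (m≤m+n a x)))

∈-filterᵇ⁻ : (p : A → Bool) (xs : List A) {x : A} → x ∈ filterᵇ p xs → x ∈ xs × p x ≡ true
∈-filterᵇ⁻ p (y ∷ xs) x∈ with p y in e
∈-filterᵇ⁻ p (y ∷ xs) (here refl) | true = here refl , e
∈-filterᵇ⁻ p (y ∷ xs) (there x∈)  | true  = map₁ there (∈-filterᵇ⁻ p xs x∈)
∈-filterᵇ⁻ p (y ∷ xs) x∈          | false = map₁ there (∈-filterᵇ⁻ p xs x∈)

∈-filterᵇ⁺ : (p : A → Bool) (xs : List A) {x : A} → x ∈ xs → p x ≡ true → x ∈ filterᵇ p xs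
∈-filterᵇ⁺ p (y ∷ xs) (here refl) px rewrite px = here refl
∈-filterᵇ⁺ p (y ∷ xs) (there x∈)  px with p y
... | true  = there (∈-filterᵇ⁺ p xs x∈ px)
... | false = ∈-filterᵇ⁺ p xs x∈ px

filterᵇ-map-comm : (p : A → Bool) (f : A → A) → (∀ z → p (f z) ≡ p z) → ∀ Z → filterᵇ p (map f Z) ≡ map f (filterᵇ p Z)
filterᵇ-map-comm p f h []      = refl
filterᵇ-map-comm p f h (z ∷ Z) rewrite h z with p z
... | true  = cong (f z ∷_) (filterᵇ-map-comm p f h Z)
... | false = filterᵇ-map-comm p f h Z

choices-singleton : (xs : List A) → choices (xs ∷ []) ≡ map (_∷ []) xs
choices-singleton []       = refl
choices-singleton (x ∷ xs) = cong ((x ∷ []) ∷_) (choices-singleton xs)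

choices-replicate-zero : ∀ L → choices (replicate L (0 ∷ [])) ≡ replicate L 0 ∷ []
choices-replicate-zero zero    = refl
choices-replicate-zero (suc L) rewrite choices-replicate-zero L = refl

∈-choices⁻ : (c : List A) (cs : List (List A)) {ys : List A} → ys ∈ choices (c ∷ cs) →
  ∃ λ x → ∃ λ ys′ → ys ≡ x ∷ ys′ × x ∈ c × ys′ ∈ choices cs
∈-choices⁻ {A} c cs {ys} ys∈ = go c (∈-concatMap⁻ (λ x → map (x ∷_) (choices cs)) {xs = c} ys∈)
  where
  go : ∀ c′ → Any (λ x → ys ∈ map (x ∷_) (choices cs)) c′ →
       ∃ λ x → ∃ λ ys′ → ys ≡ x ∷ ys′ × x ∈ c′ × ys′ ∈ choices cs
  go (x ∷ c′) (here ys∈′) with ∈-map⁻ (x ∷_) ys∈′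
  ... | ys′ , ys′∈ , refl = x , ys′ , refl , here refl , ys′∈
  go (x ∷ c′) (there any) with go c′ any
  ... | x′ , ys′ , e , x′∈ , ys′∈ = x′ , ys′ , e , there x′∈ , ys′∈

∈-choices⁺ : (c : List A) (cs : List (List A)) {x : A} {ys : List A} → x ∈ c → ys ∈ choices cs → (x ∷ ys) ∈ choices (c ∷ cs)
∈-choices⁺ (y ∷ c) cs (here refl) ys∈ = ∈-++⁺ˡ (∈-map⁺ (y ∷_) ys∈)
∈-choices⁺ (y ∷ c) cs (there x∈)  ys∈ = ∈-++⁺ʳ (map (y ∷_) (choices cs)) (∈-choices⁺ c cs x∈ ys∈)

∈-choices-replicate : ∀ (X : List A) xs → All (_∈ X) xs → xs ∈ choices (replicate (length xs) X)
∈-choices-replicate X []       []          = here refl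
∈-choices-replicate X (x ∷ xs) (x∈ ∷ xs⊆) = ∈-choices⁺ X (replicate (length xs) X) x∈ (∈-choices-replicate X xs xs⊆)

length-∈-choices : (cs : List (List A)) {r : List A} → r ∈ choices cs → length r ≡ length cs
length-∈-choices []       (here refl) = refl
length-∈-choices (c ∷ cs) r∈ with ∈-choices⁻ c cs r∈
... | _ , _ , refl , _ , r′∈ = cong suc (length-∈-choices cs r′∈)

length-∈-choices-replicate : ∀ L (X : List A) {r : List A} → r ∈ choices (replicate L X) → length r ≡ L
length-∈-choices-replicate L X r∈ = trans (length-∈-choices (replicate L X) r∈) (length-replicate L)

length-zipWith≤ʳ : {C : Set} (f : A → B′ → C) (xs : List A) (ys : List B′) → length (zipWith f xs ys) ≤ length ys
length-zipWith≤ʳ f []       ys       = z≤n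
length-zipWith≤ʳ f (x ∷ xs) []       = z≤n
length-zipWith≤ʳ f (x ∷ xs) (y ∷ ys) = s≤s (length-zipWith≤ʳ f xs ys)

∈⇒≤sum : ∀ {x} xs → x ∈ xs → x ≤ sum xs
∈⇒≤sum (y ∷ xs) (here refl) = m≤m+n y (sum xs)
∈⇒≤sum (y ∷ xs) (there x∈)  = ≤-trans (∈⇒≤sum xs x∈) (m≤n+m (sum xs) y)

unique-same-elements⇒↭ : {xs ys : List A} → Unique xs → Unique ys →
  (∀ {x} → x ∈ xs → x ∈ ys) → (∀ {x} → x ∈ ys → x ∈ xs) → xs ↭ ys
unique-same-elements⇒↭ xs-unique ys-unique xs⊆ys ys⊆xs =
  ∼bag⇒↭ (unique∧set⇒bag xs-unique ys-unique (λ {x} → mk⇔ (xs⊆ys {x}) (ys⊆xs {x})))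

𝟙-∧ : ∀ a b → 𝟙 (a ∧ b) ≡ 𝟙 a * 𝟙 b
𝟙-∧ true  b = sym (+-identityʳ _)
𝟙-∧ false b = refl

𝟙-∧-* : ∀ a b n → 𝟙 (a ∧ b) * n ≡ 𝟙 a * (𝟙 b * n)
𝟙-∧-* true  b n = sym (+-identityʳ _)
𝟙-∧-* false b n = refl

𝟙-*-cong : ∀ c {x y} → (c ≡ true → x ≡ y) → 𝟙 c * x ≡ 𝟙 c * y
𝟙-*-cong true  h = cong (_+ 0) (h refl)
𝟙-*-cong false h = refl

𝟙-*-false : ∀ {c} n → c ≡ false → 𝟙 c * n ≡ 0
𝟙-*-false n refl = refl

𝟙-*≢0⁻ : ∀ c y → 𝟙 c * y ≢ 0 → c ≡ true × y ≢ 0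
𝟙-*≢0⁻ true  y h = refl , (λ e → h (trans (+-identityʳ y) e))
𝟙-*≢0⁻ false y h = ⊥-elim (h refl)

module _ (eqᵇ : A → A → Bool) (sound : ∀ {x y} → eqᵇ x y ≡ true → x ≡ y) (eqᵇ-refl : ∀ x → eqᵇ x x ≡ true) where

  private
    eqᵇ-false : ∀ {x y} → x ≢ y → eqᵇ x y ≡ false
    eqᵇ-false {x} {y} x≢y with eqᵇ x y in e
    ... | true  = ⊥-elim (x≢y (sound e))
    ... | false = refl

  ∑-δ : {a : A} {xs : List A} → a ∈ xs → Unique xs → (f : A → ℕ) → ∑ xs (λ x → 𝟙 (eqᵇ x a) * f x) ≡ f a
  ∑-δ {xs = x ∷ xs} (here refl) (x∉xs ∷ _) f rewrite eqᵇ-refl x =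
    trans (cong₂ _+_ (+-identityʳ (f x))
                     (∑-zero-∈ {xs = xs} (λ {y} y∈xs →
                        𝟙-*-false (f y) (eqᵇ-false {y} {x} (λ y≡x → All.lookup x∉xs y∈xs (sym y≡x))))))
          (+-identityʳ (f x))
  ∑-δ {a} {xs = x ∷ xs} (there a∈xs) (x∉xs ∷ u) f =
    trans (cong (_+ ∑ xs (λ y → 𝟙 (eqᵇ y a) * f y))
                (𝟙-*-false (f x) (eqᵇ-false {x} {a} (λ { refl → All.lookup x∉xs a∈xs refl }))))
          (∑-δ a∈xs u f)

∑-δℕ : {a : ℕ} {xs : List ℕ} → a ∈ xs → Unique xs → (f : ℕ → ℕ) → ∑ xs (λ x → 𝟙 (x ≡ᵇ a) * f x) ≡ f a
∑-δℕ = ∑-δ _≡ᵇ_ ≡ᵇ-sound ≡ᵇ-refl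

∑-δ-upTo : ∀ n c (f : ℕ → ℕ) → ∑ (upTo n) (λ a → 𝟙 (a ≡ᵇ c) * f a) ≡ 𝟙 (c <ᵇ n) * f c
∑-δ-upTo n c f with c <? n
... | yes c<n rewrite <ᵇ-true c<n = trans (∑-δℕ (∈-upTo⁺ c<n) (Unique.upTo⁺ n) f) (sym (+-identityʳ (f c)))
... | no c≮n rewrite <ᵇ-false c≮n =
  ∑-zero-∈ {xs = upTo n} (λ {a} a∈ → 𝟙-*-false (f a) (≡ᵇ-false {a} {c} (λ { refl → c≮n (∈-upTo⁻ a∈) })))

𝟙-any≡∑ : (p : A → Bool) (xs : List A) → Unique xs → (∀ x y → p x ≡ true → p y ≡ true → x ≡ y) →
  𝟙 (any p xs) ≡ ∑ xs (𝟙 ∘ p)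
𝟙-any≡∑ p []       _              _        = refl
𝟙-any≡∑ p (x ∷ xs) (x∉xs ∷ uniq) p-unique with p x in px
... | true  = cong suc (sym (∑-zero-∈ {xs = xs} (λ {y} y∈xs → py≡0 y (All.lookup x∉xs y∈xs))))
  where
  py≡0 : ∀ y → x ≢ y → 𝟙 (p y) ≡ 0
  py≡0 y x≢y with p y in py
  ... | true  = ⊥-elim (x≢y (p-unique x y px py))
  ... | false = refl
... | false = 𝟙-any≡∑ p xs uniq p-unique

∑-reindex : (xs : List ℕ) (F : ℕ → ℕ) (f : A → ℕ) (W : List A) → Unique xs → Unique (map f W) →
  All (λ z → f z ∈ xs) W → (∀ {j} → j ∈ xs → ¬ (j ∈ map f W) → F j ≡ 0) → ∑ xs F ≡ ∑ W (F ∘ f)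
∑-reindex xs F f []      _      _               _               off-image = ∑-zero-∈ (λ j∈ → off-image j∈ (λ ()))
∑-reindex xs F f (w ∷ W) xs-uniq (fw∉fW ∷ fW-uniq) (fw∈xs ∷ fW⊆xs) off-image =
  begin
    ∑ xs F
  ≡⟨ ∑-cong split xs ⟩
    ∑ xs (λ j → 𝟙 (j ≡ᵇ f w) * F j + F′ j)
  ≡⟨ ∑-+ xs (λ j → 𝟙 (j ≡ᵇ f w) * F j) F′ ⟩
    ∑ xs (λ j → 𝟙 (j ≡ᵇ f w) * F j) + ∑ xs F′
  ≡⟨ cong₂ _+_ (∑-δℕ fw∈xs xs-uniq F) (∑-reindex xs F′ f W xs-uniq fW-uniq fW⊆xs off-image′) ⟩
    F (f w) + ∑ W (F′ ∘ f)
  ≡⟨ cong (F (f w) +_) (∑-cong-∈ (λ z∈ → F′≡F (All.lookup fw∉fW (∈-map⁺ f z∈)))) ⟩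
    F (f w) + ∑ W (F ∘ f)
  ∎
  where
  open ≡-Reasoning
  F′ : ℕ → ℕ
  F′ j = if j ≡ᵇ f w then 0 else F j
  split : ∀ j → F j ≡ 𝟙 (j ≡ᵇ f w) * F j + F′ j
  split j with j ≡ᵇ f w
  ... | true  = sym (trans (+-identityʳ _) (+-identityʳ _))
  ... | false = refl
  off-image′ : ∀ {j} → j ∈ xs → ¬ (j ∈ map f W) → F′ j ≡ 0
  off-image′ {j} j∈ j∉ with j ≡ᵇ f w in e
  ... | true  = refl
  ... | false = off-image j∈ λ { (here refl) → false≢true (trans (sym e) (≡ᵇ-refl (f w))) ; (there j∈′) → j∉ j∈′ }
  F′≡F : ∀ {j} → f w ≢ j → F′ j ≡ F j
  F′≡F {j} ne rewrite ≡ᵇ-false {j} {f w} (ne ∘ sym) = refl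

product-ones : (xs : List ℕ) → All (_≡ 1) xs → product xs ≡ 1
product-ones []       []          = refl
product-ones (x ∷ xs) (refl ∷ h) rewrite product-ones xs h = refl

product-zero : (xs : List ℕ) → Any (_≡ 0) xs → product xs ≡ 0
product-zero (x ∷ xs) (here refl) = refl
product-zero (x ∷ xs) (there any) rewrite product-zero xs any = *-zeroʳ x

product-if-∉ : ∀ R k a (G : ℕ → ℕ) → All (k ≢_) R → product (map (λ u → if u ≡ᵇ k then a else G u) R) ≡ product (map G R)
product-if-∉ []      k a G []         = refl
product-if-∉ (u ∷ R) k a G (ne ∷ nes) rewrite ≡ᵇ-false {u} {k} (ne ∘ sym) = cong (G u *_) (product-if-∉ R k a G nes)

product-distrib-∑-at : ∀ R k → k ∈ R → Unique R → (xs : List A) (c F : A → ℕ) (G : ℕ → ℕ) →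
  product (map (λ u → if u ≡ᵇ k then ∑ xs (λ x → c x * F x) else G u) R) ≡
  ∑ xs (λ x → c x * product (map (λ u → if u ≡ᵇ k then F x else G u) R))
product-distrib-∑-at (u ∷ R) .u (here refl) (u∉R ∷ _) xs c F G
  rewrite ≡ᵇ-refl u | product-if-∉ R u (∑ xs (λ x → c x * F x)) G u∉R =
  sym (trans (∑-cong (λ x → trans (cong (λ y → c x * (F x * y)) (product-if-∉ R u (F x) G u∉R)) (sym (*-assoc (c x) (F x) _))) xs)
             (∑-*ʳ (product (map G R)) xs (λ x → c x * F x)))
product-distrib-∑-at (u ∷ R) k (there k∈R) (u∉R ∷ uniq) xs c F G
  rewrite ≡ᵇ-false {u} {k} (λ { refl → All.lookup u∉R k∈R refl }) | product-distrib-∑-at R k k∈R uniq xs c F G =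
  sym (trans (∑-cong (λ x → *-CS.x∙yz≈y∙xz (c x) (G u) _) xs) (∑-*ˡ (G u) xs _))

∑-*-∑-interchange : (k : ℕ) (J : List A) (C : List B′) (I : A → ℕ) (c : B′ → ℕ) (Y : B′ → A → ℕ) →
  k * ∑ J (λ j → I j * ∑ C (λ x → c x * Y x j)) ≡ ∑ C (λ x → (k * c x) * ∑ J (λ j → I j * Y x j))
∑-*-∑-interchange k J C I c Y = begin
    k * ∑ J (λ j → I j * ∑ C (λ x → c x * Y x j))
  ≡⟨ cong (k *_) (∑-cong (λ j → sym (∑-*ˡ (I j) C _)) J) ⟩
    k * ∑ J (λ j → ∑ C (λ x → I j * (c x * Y x j)))
  ≡⟨ cong (k *_) (∑-comm J C _) ⟩
    k * ∑ C (λ x → ∑ J (λ j → I j * (c x * Y x j)))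
  ≡⟨ sym (∑-*ˡ k C _) ⟩
    ∑ C (λ x → k * ∑ J (λ j → I j * (c x * Y x j)))
  ≡⟨ ∑-cong (λ x → cong (k *_) (trans (∑-cong (λ j → *-CS.x∙yz≈y∙xz (I j) (c x) _) J) (∑-*ˡ (c x) J _))) C ⟩
    ∑ C (λ x → k * (c x * ∑ J (λ j → I j * Y x j)))
  ≡⟨ ∑-cong (λ x → sym (*-assoc k (c x) _)) C ⟩
    ∑ C (λ x → (k * c x) * ∑ J (λ j → I j * Y x j))
  ∎
  where open ≡-Reasoning

Exponents : Set
Exponents = ℕ → ℕ → ℕ

∈-from1⁻ : ∀ {B x} → x ∈ from1 B → 0 < x × x < B
∈-from1⁻ {suc B} x∈ with ∈-applyUpTo⁻ suc x∈
... | i , i<B , refl = s≤s z≤n , s≤s i<B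

∈-from1⁺ : ∀ {B x} → 0 < x → x < B → x ∈ from1 B
∈-from1⁺ {suc B} {suc x} _ (s≤s x<B) = ∈-applyUpTo⁺ suc x<B

from1-unique : ∀ B → Unique (from1 B)
from1-unique B = Unique.drop⁺ 1 (Unique.upTo⁺ B)

positions≡cartesianProduct : ∀ B → positions B ≡ cartesianProduct (from1 B) (from1 B)
positions≡cartesianProduct B = go (from1 B)
  where
  go : ∀ is → concatMap (λ i → map (i ,_) (from1 B)) is ≡ cartesianProduct is (from1 B)
  go []       = refl
  go (i ∷ is) = cong (map (i ,_) (from1 B) ++_) (go is)

inRangeᵇ⁻ : ∀ {B i j} → inRangeᵇ B i j ≡ true → i ∈ from1 B × j ∈ from1 B
inRangeᵇ⁻ {B} {i} {j} h with ∧-true⁻ {0 <ᵇ i} h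
... | 0<i , h′ with ∧-true⁻ {i <ᵇ B} h′
... | i<B , h″ with ∧-true⁻ {0 <ᵇ j} h″
... | 0<j , j<B = ∈-from1⁺ {B} (<ᵇ-sound 0<i) (<ᵇ-sound i<B) , ∈-from1⁺ {B} (<ᵇ-sound 0<j) (<ᵇ-sound j<B)

inRangeᵇ⁺ : ∀ {B i j} → i ∈ from1 B → j ∈ from1 B → inRangeᵇ B i j ≡ true
inRangeᵇ⁺ {B} i∈ j∈ with ∈-from1⁻ {B} i∈ | ∈-from1⁻ {B} j∈
... | 0<i , i<B | 0<j , j<B
  rewrite <ᵇ-true 0<i | <ᵇ-true i<B | <ᵇ-true 0<j | <ᵇ-true j<B = refl

∈-positions⁻ : ∀ {B i j} → (i , j) ∈ positions B → inRangeᵇ B i j ≡ true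
∈-positions⁻ {B} ij∈ with ∈-cartesianProduct⁻ (from1 B) (from1 B) (subst (_ ∈_) (positions≡cartesianProduct B) ij∈)
... | i∈ , j∈ = inRangeᵇ⁺ {B} i∈ j∈

∈-positions⁺ : ∀ {B i j} → inRangeᵇ B i j ≡ true → (i , j) ∈ positions B
∈-positions⁺ {B} h with inRangeᵇ⁻ {B} h
... | i∈ , j∈ = subst (_ ∈_) (sym (positions≡cartesianProduct B)) (∈-cartesianProduct⁺ i∈ j∈)

positions-unique : ∀ B → Unique (positions B)
positions-unique B = subst Unique (sym (positions≡cartesianProduct B))
  (Unique.cartesianProduct⁺ (from1-unique B) (from1-unique B))

expo-inRange : ∀ B (t : Exponents) {i j} → inRangeᵇ B i j ≡ true → expo (mono B t) i j ≡ t i j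
expo-inRange B t r rewrite r = refl

expo-∈-positions : ∀ B (t : Exponents) {i j} → (i , j) ∈ positions B → expo (mono B t) i j ≡ t i j
expo-∈-positions B t ij∈ = expo-inRange B t (∈-positions⁻ {B} ij∈)

if-then-0-cong : ∀ (c : Bool) {x y : ℕ} → (c ≡ true → x ≡ y) → (if c then x else 0) ≡ (if c then y else 0)
if-then-0-cong true  h = h refl
if-then-0-cong false h = refl

-- A monomial has many presentations (mono B t); only its exponents matter.
SameExpo : ℕ → Exponents → Exponents → Set
SameExpo B f g = ∀ i j → expo (mono B f) i j ≡ expo (mono B g) i j

WellDefined : Series → Set
WellDefined F = ∀ B f g → SameExpo B f g → F (mono B f) ≡ F (mono B g)

oneS-wellDefined : WellDefined oneS
oneS-wellDefined B f g h =
  cong 𝟙 (all-cong (λ ij → cong (_≡ᵇ 0) (h (proj₁ ij) (proj₂ ij))) (positions B))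

below-cong : (ps : List (ℕ × ℕ)) {e e′ : Exponents} → (∀ i j → e i j ≡ e′ i j) → below ps e ≡ below ps e′
below-cong []             h = refl
below-cong ((i , j) ∷ ps) h rewrite below-cong ps h | h i j = refl

⊛-wellDefined : ∀ F G → WellDefined G → WellDefined (F ⊛ G)
⊛-wellDefined F G G-wd B f g h rewrite below-cong (positions B) h =
  ∑-cong (λ ν → cong (F (mono B ν) *_) (G-wd B _ _ (λ i j →
            if-then-0-cong (inRangeᵇ B i j) (λ _ → cong (_∸ ν i j) (h i j)))))
         (below (positions B) (expo (mono B g)))

prodS-wellDefined : ∀ Fs → WellDefined (prodS Fs)
prodS-wellDefined []       = oneS-wellDefined
prodS-wellDefined (F ∷ Fs) = ⊛-wellDefined F (prodS Fs) (prodS-wellDefined Fs)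

P-wellDefined : ∀ τ → WellDefined (P τ)
P-wellDefined τ = prodS-wellDefined (map Pstack τ)

keyEqᵇ : ℕ × ℕ → ℕ × ℕ → Bool
keyEqᵇ p q = (proj₁ p ≡ᵇ proj₁ q) ∧ (proj₂ p ≡ᵇ proj₂ q)

keyEqᵇ-refl : ∀ p → keyEqᵇ p p ≡ true
keyEqᵇ-refl (a , b) rewrite ≡ᵇ-refl a | ≡ᵇ-refl b = refl

keyEqᵇ-sound : ∀ {p q} → keyEqᵇ p q ≡ true → p ≡ q
keyEqᵇ-sound {a , b} {c , d} h with ∧-true⁻ {a ≡ᵇ c} h
... | a≡c , b≡d = cong₂ _,_ (≡ᵇ-sound a≡c) (≡ᵇ-sound b≡d)

keyEqᵇ-false : ∀ {p q} → p ≢ q → keyEqᵇ p q ≡ false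
keyEqᵇ-false {p} {q} p≢q with keyEqᵇ p q in e
... | true  = ⊥-elim (p≢q (keyEqᵇ-sound e))
... | false = refl

xpow : ℕ → ℕ → ℕ → Exponents
xpow k j v a b = if keyEqᵇ (k , j) (a , b) then v else 0

xpow-here : ∀ k j v → xpow k j v k j ≡ v
xpow-here k j v rewrite keyEqᵇ-refl (k , j) = refl

xpow-elsewhere : ∀ k j j′ v → j′ ≢ j → xpow k j′ v k j ≡ 0
xpow-elsewhere k j j′ v j′≢j rewrite keyEqᵇ-false {k , j′} {k , j} (j′≢j ∘ cong proj₂) = refl

xpow-* : ∀ k j q m a b → xpow k j q a b * m ≡ xpow k j (q * m) a b
xpow-* k j q m a b with keyEqᵇ (k , j) (a , b)
... | true  = refl
... | false = refl

setAt-here : ∀ f i j a → setAt f i j a i j ≡ a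
setAt-here f i j a rewrite ≡ᵇ-refl i | ≡ᵇ-refl j = refl

setAt-elsewhere : ∀ f i j a {i′ j′} → (i′ , j′) ≢ (i , j) → setAt f i j a i′ j′ ≡ f i′ j′
setAt-elsewhere f i j a ne rewrite keyEqᵇ-false ne = refl

setAt-self : ∀ f i j i′ j′ → setAt f i j (f i j) i′ j′ ≡ f i′ j′
setAt-self f i j i′ j′ with keyEqᵇ (i′ , j′) (i , j) in e
... | true  = cong (λ p → f (proj₁ p) (proj₂ p)) (sym (keyEqᵇ-sound e))
... | false = refl

agreeᵇ : List (ℕ × ℕ) → Exponents → Exponents → Bool
agreeᵇ ps f g = all (λ p → f (proj₁ p) (proj₂ p) ≡ᵇ g (proj₁ p) (proj₂ p)) ps

boundedᵇ : List (ℕ × ℕ) → Exponents → Exponents → Bool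
boundedᵇ ps f g = all (λ p → f (proj₁ p) (proj₂ p) <ᵇ suc (g (proj₁ p) (proj₂ p))) ps

AgreeOn : List (ℕ × ℕ) → Exponents → Exponents → Set
AgreeOn ps f g = All (λ p → f (proj₁ p) (proj₂ p) ≡ g (proj₁ p) (proj₂ p)) ps

agreeᵇ-setAt : ∀ {ps} i j f a s → All ((i , j) ≢_) ps → agreeᵇ ps (setAt f i j a) s ≡ agreeᵇ ps f s
agreeᵇ-setAt i j f a s []                = refl
agreeᵇ-setAt i j f a s (ij≢p ∷ ij∉ps) =
  cong₂ _∧_ (cong (_≡ᵇ _) (setAt-elsewhere f i j a (ij≢p ∘ sym))) (agreeᵇ-setAt i j f a s ij∉ps)

AgreeOn-setAt : ∀ {ps} i j x {ν ν′} → All ((i , j) ≢_) ps → AgreeOn ps ν ν′ →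
  AgreeOn ((i , j) ∷ ps) (setAt ν i j x) (setAt ν′ i j x)
AgreeOn-setAt i j x {ν} {ν′} ij∉ps agree = trans (setAt-here ν i j x) (sym (setAt-here ν′ i j x)) ∷ go ij∉ps agree
  where
  go : ∀ {qs} → All ((i , j) ≢_) qs → AgreeOn qs ν ν′ → AgreeOn qs (setAt ν i j x) (setAt ν′ i j x)
  go []           []       = []
  go (ne ∷ ij∉qs) (h ∷ hs) =
    trans (setAt-elsewhere ν i j x (ne ∘ sym)) (trans h (sym (setAt-elsewhere ν′ i j x (ne ∘ sym)))) ∷ go ij∉qs hs

∑-below-δ : (ps : List (ℕ × ℕ)) → Unique ps → (e s : Exponents) (h : Exponents → ℕ) →
  (∀ ν ν′ → AgreeOn ps ν ν′ → h ν ≡ h ν′) →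
  ∑ (below ps e) (λ ν → 𝟙 (agreeᵇ ps ν s) * h ν) ≡ 𝟙 (boundedᵇ ps s e) * h s
∑-below-δ []             _               e s h h-resp = trans (+-identityʳ _) (cong (_+ 0) (h-resp _ _ []))
∑-below-δ ((i , j) ∷ ps) (ij∉ps ∷ uniq) e s h h-resp =
  begin
    ∑ (concatMap (λ f → map (setAt f i j) (upTo (suc (e i j)))) (below ps e)) F
  ≡⟨ ∑-concatMap _ (below ps e) F ⟩
    ∑ (below ps e) (λ f → ∑ (map (setAt f i j) (upTo (suc (e i j)))) F)
  ≡⟨ ∑-cong (λ f → trans (∑-map (setAt f i j) (upTo (suc (e i j))) F) (column f)) (below ps e) ⟩
    ∑ (below ps e) (λ f → 𝟙 c * (𝟙 (agreeᵇ ps f s) * h (setAt f i j (s i j))))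
  ≡⟨ ∑-cong (λ f → *-CS.x∙yz≈y∙xz (𝟙 c) (𝟙 (agreeᵇ ps f s)) _) (below ps e) ⟩
    ∑ (below ps e) (λ f → 𝟙 (agreeᵇ ps f s) * (𝟙 c * h (setAt f i j (s i j))))
  ≡⟨ ∑-below-δ ps uniq e s (λ f → 𝟙 c * h (setAt f i j (s i j))) h′-resp ⟩
    𝟙 (boundedᵇ ps s e) * (𝟙 c * h (setAt s i j (s i j)))
  ≡⟨ trans (*-CS.x∙yz≈y∙xz (𝟙 (boundedᵇ ps s e)) (𝟙 c) _) (sym (𝟙-∧-* c _ _)) ⟩
    𝟙 (c ∧ boundedᵇ ps s e) * h (setAt s i j (s i j))
  ≡⟨ cong (𝟙 (c ∧ boundedᵇ ps s e) *_) (h-resp _ _ (All.tabulate (λ {p} _ → setAt-self s i j (proj₁ p) (proj₂ p)))) ⟩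
    𝟙 (c ∧ boundedᵇ ps s e) * h s
  ∎
  where
  open ≡-Reasoning
  c = s i j <ᵇ suc (e i j)
  F : Exponents → ℕ
  F ν = 𝟙 (agreeᵇ ((i , j) ∷ ps) ν s) * h ν
  column : ∀ f → ∑ (upTo (suc (e i j))) (λ a → F (setAt f i j a))
               ≡ 𝟙 c * (𝟙 (agreeᵇ ps f s) * h (setAt f i j (s i j)))
  column f = trans (∑-cong (λ a → trans (cong (λ x → 𝟙 ((x ≡ᵇ s i j) ∧ agreeᵇ ps (setAt f i j a) s) * h (setAt f i j a))
                                               (setAt-here f i j a))
                                    (trans (cong (λ b → 𝟙 ((a ≡ᵇ s i j) ∧ b) * h (setAt f i j a)) (agreeᵇ-setAt i j f a s ij∉ps))
                                           (𝟙-∧-* (a ≡ᵇ s i j) (agreeᵇ ps f s) _)))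
                           (upTo (suc (e i j))))
                   (∑-δ-upTo (suc (e i j)) (s i j) (λ a → 𝟙 (agreeᵇ ps f s) * h (setAt f i j a)))
  h′-resp : ∀ ν ν′ → AgreeOn ps ν ν′ → 𝟙 c * h (setAt ν i j (s i j)) ≡ 𝟙 c * h (setAt ν′ i j (s i j))
  h′-resp ν ν′ agree = cong (𝟙 c *_) (h-resp _ _ (AgreeOn-setAt i j (s i j) ij∉ps agree))

-- Multiplying by a power sum P_{d^m}

divisorPairs-sound : ∀ d → All (λ kq → 0 < proj₁ kq × proj₁ kq * proj₂ kq ≡ d) (divisorPairs d)
divisorPairs-sound d = All.tabulate sound
  where
  sound : ∀ {kq} → kq ∈ divisorPairs d → 0 < proj₁ kq × proj₁ kq * proj₂ kq ≡ d
  sound kq∈ with ∈-map⁻ (λ k′ → (suc k′ , d / suc k′)) kq∈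
  ... | k′ , k′∈ , refl with ∈-filterᵇ⁻ (λ k′ → (d % suc k′) ≡ᵇ 0) (upTo d) k′∈
  ... | _ , d%k≡0 = s≤s z≤n , sym (trans (m≡m%n+[m/n]*n d (suc k′))
                                         (trans (cong (_+ (d / suc k′) * suc k′) (≡ᵇ-sound d%k≡0))
                                                (*-comm (d / suc k′) (suc k′))))

divisorPairs-quotient-pos : ∀ d → 0 < d → All (λ kq → 0 < proj₂ kq) (divisorPairs d)
divisorPairs-quotient-pos d 0<d = All.map pos (divisorPairs-sound d)
  where
  pos : ∀ {kq} → 0 < proj₁ kq × proj₁ kq * proj₂ kq ≡ d → 0 < proj₂ kq
  pos {k , zero}  (_ , kq≡d) = ⊥-elim (<⇒≢ 0<d (trans (sym (*-zeroʳ k)) kq≡d))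
  pos {k , suc q} _          = s≤s z≤n

sumS-coefficient : (F : A → Series) (xs : List A) (μ : Mono) → sumS (map F xs) μ ≡ ∑ xs (λ x → F x μ)
sumS-coefficient F []       μ = refl
sumS-coefficient F (x ∷ xs) μ = cong (F x μ +_) (sumS-coefficient F xs μ)

M-singleton : ∀ k q B ν → M ((k , q) ∷ []) (mono B ν) ≡
  𝟙 (any (λ j → inRangeᵇ B k j ∧ agreeᵇ (positions B) (expo (mono B ν)) (xpow k j q)) (from1 B))
M-singleton k q B ν rewrite choices-singleton (from1 B) =
  cong 𝟙 (trans (any-map _ (_∷ []) (from1 B)) (any-cong term (from1 B)))
  where
  term : ∀ j → true ∧ ((inRangeᵇ B k j ∧ true) ∧ all (λ ij → expo (mono B ν) (proj₁ ij) (proj₂ ij)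
                                                       ≡ᵇ termExp (((k , j) , q) ∷ []) (proj₁ ij) (proj₂ ij)) (positions B))
             ≡ (inRangeᵇ B k j ∧ agreeᵇ (positions B) (expo (mono B ν)) (xpow k j q))
  term j rewrite ∧-identityʳ (inRangeᵇ B k j) =
    cong (inRangeᵇ B k j ∧_) (all-cong (λ ij → cong (expo (mono B ν) (proj₁ ij) (proj₂ ij) ≡ᵇ_) (+-identityʳ _)) (positions B))

xpow-match-unique : ∀ B k v ν → 0 < v → ∀ j j′ →
  (inRangeᵇ B k j  ∧ agreeᵇ (positions B) (expo (mono B ν)) (xpow k j v)) ≡ true →
  (inRangeᵇ B k j′ ∧ agreeᵇ (positions B) (expo (mono B ν)) (xpow k j′ v)) ≡ true → j ≡ j′
xpow-match-unique B k v ν 0<v j j′ h h′ with j ≟ j′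
... | yes j≡j′ = j≡j′
... | no  j≢j′ with ∧-true⁻ {inRangeᵇ B k j} h | ∧-true⁻ {inRangeᵇ B k j′} h′
... | inRange , agree | _ , agree′ = ⊥-elim (<⇒≢ 0<v (sym (begin
    v                      ≡⟨ sym (xpow-here k j v) ⟩
    xpow k j v k j         ≡⟨ sym (at agree) ⟩
    expo (mono B ν) k j    ≡⟨ at agree′ ⟩
    xpow k j′ v k j        ≡⟨ xpow-elsewhere k j j′ v (j≢j′ ∘ sym) ⟩
    0                      ∎)))
  where
  open ≡-Reasoning
  at : ∀ {s} → agreeᵇ (positions B) (expo (mono B ν)) s ≡ true → expo (mono B ν) k j ≡ s k j
  at {s} agree = ≡ᵇ-sound {expo (mono B ν) k j} {s k j} (All.lookup (all-true⁻ (positions B) agree) (∈-positions⁺ {B} {k} {j} inRange))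

divisible-matchᵇ : ∀ x s m → ((x % suc m ≡ᵇ 0) ∧ (x / suc m ≡ᵇ s)) ≡ (x ≡ᵇ s * suc m)
divisible-matchᵇ x s m with x ≟ s * suc m
... | yes refl rewrite m*n%n≡0 s (suc m) ⦃ _ ⦄ | m*n/n≡m s (suc m) ⦃ _ ⦄ | ≡ᵇ-refl s | ≡ᵇ-refl (s * suc m) = refl
... | no  x≢sm rewrite ≡ᵇ-false x≢sm with x % suc m ≡ᵇ 0 in e₁ | x / suc m ≡ᵇ s in e₂
...   | true  | true  = ⊥-elim (x≢sm (trans (m≡m%n+[m/n]*n x (suc m))
                           (cong₂ (λ a b → a + b * suc m) (≡ᵇ-sound {x % suc m} e₁) (≡ᵇ-sound {x / suc m} e₂))))
...   | true  | false = refl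
...   | false | _     = refl

module _ (B m : ℕ) (ν : Exponents) where

  divisibleᵇ : Bool
  divisibleᵇ = all (λ ij → (expo (mono B ν) (proj₁ ij) (proj₂ ij) % suc m) ≡ᵇ 0) (positions B)

  quotientExpo : Exponents
  quotientExpo i j = expo (mono B ν) i j / suc m

  agree-xpow-scaled : ∀ k j q →
    agreeᵇ (positions B) (expo (mono B ν)) (xpow k j (q * suc m))
      ≡ divisibleᵇ ∧ agreeᵇ (positions B) (expo (mono B quotientExpo)) (xpow k j q)
  agree-xpow-scaled k j q = sym (begin
      divisibleᵇ ∧ agreeᵇ (positions B) (expo (mono B quotientExpo)) (xpow k j q)
    ≡⟨ cong (divisibleᵇ ∧_) (all-cong-∈ (λ {ij} ij∈ → cong (_≡ᵇ xpow k j q (proj₁ ij) (proj₂ ij))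
         (expo-∈-positions B quotientExpo ij∈))) ⟩
      divisibleᵇ ∧ all (λ ij → expo (mono B ν) (proj₁ ij) (proj₂ ij) / suc m ≡ᵇ xpow k j q (proj₁ ij) (proj₂ ij)) (positions B)
    ≡⟨ sym (all-∧ _ _ (positions B)) ⟩
      all (λ ij → (expo (mono B ν) (proj₁ ij) (proj₂ ij) % suc m ≡ᵇ 0)
                ∧ (expo (mono B ν) (proj₁ ij) (proj₂ ij) / suc m ≡ᵇ xpow k j q (proj₁ ij) (proj₂ ij))) (positions B)
    ≡⟨ all-cong (λ ij → trans (divisible-matchᵇ (expo (mono B ν) (proj₁ ij) (proj₂ ij)) (xpow k j q (proj₁ ij) (proj₂ ij)) m)
                             (cong (expo (mono B ν) (proj₁ ij) (proj₂ ij) ≡ᵇ_) (xpow-* k j q (suc m) (proj₁ ij) (proj₂ ij)))) (positions B) ⟩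
      agreeᵇ (positions B) (expo (mono B ν)) (xpow k j (q * suc m))
    ∎)
    where open ≡-Reasoning

Pstack-coefficient : ∀ d m B ν → 0 < d →
  Pstack (d , suc m) (mono B ν) ≡
  ∑ (divisorPairs d) (λ kq → proj₁ kq * ∑ (from1 B) (λ j →
      𝟙 (inRangeᵇ B (proj₁ kq) j ∧ agreeᵇ (positions B) (expo (mono B ν)) (xpow (proj₁ kq) j (proj₂ kq * suc m)))))
Pstack-coefficient d m B ν 0<d with divisibleᵇ B m ν in div
... | true = trans (sumS-coefficient (λ kq → scale (proj₁ kq) (M (kq ∷ []))) (divisorPairs d) _)
                   (∑-cong-∈ (λ {kq} kq∈ → term kq (All.lookup (divisorPairs-quotient-pos d 0<d) kq∈)))
  where
  agree-scaled : ∀ k j q → agreeᵇ (positions B) (expo (mono B (quotientExpo B m ν))) (xpow k j q)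
                         ≡ agreeᵇ (positions B) (expo (mono B ν)) (xpow k j (q * suc m))
  agree-scaled k j q = sym (trans (agree-xpow-scaled B m ν k j q) (cong (_∧ agreeᵇ (positions B) (expo (mono B (quotientExpo B m ν))) (xpow k j q)) div))
  term : ∀ kq → 0 < proj₂ kq →
    proj₁ kq * M (kq ∷ []) (mono B (quotientExpo B m ν)) ≡
    proj₁ kq * ∑ (from1 B) (λ j → 𝟙 (inRangeᵇ B (proj₁ kq) j ∧ agreeᵇ (positions B) (expo (mono B ν)) (xpow (proj₁ kq) j (proj₂ kq * suc m))))
  term (k , q) 0<q = cong (k *_) (trans (M-singleton k q B _)
    (trans (cong 𝟙 (any-cong (λ j → cong (inRangeᵇ B k j ∧_) (agree-scaled k j q)) (from1 B)))
           (𝟙-any≡∑ _ (from1 B) (from1-unique B) (xpow-match-unique B k (q * suc m) ν (*-mono-< 0<q (s≤s z≤n))))))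
... | false = sym (∑-zero (λ kq → trans (cong (proj₁ kq *_) (∑-zero (λ j → no-match (proj₁ kq) j (proj₂ kq)) (from1 B)))
                                        (*-zeroʳ (proj₁ kq)))
                          (divisorPairs d))
  where
  no-match : ∀ k j q → 𝟙 (inRangeᵇ B k j ∧ agreeᵇ (positions B) (expo (mono B ν)) (xpow k j (q * suc m))) ≡ 0
  no-match k j q rewrite agree-xpow-scaled B m ν k j q | div = cong 𝟙 (∧-zeroʳ (inRangeᵇ B k j))

dividesᵇ : ℕ → ℕ → ℕ → ℕ → Exponents → Bool
dividesᵇ B k j v t = inRangeᵇ B k j ∧ (v <ᵇ suc (expo (mono B t) k j))

quotient : ℕ → ℕ → ℕ → ℕ → Exponents → Exponents
quotient B k j v t a b = expo (mono B t) a b ∸ xpow k j v a b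

boundedᵇ-xpow : ∀ B k j v (e : Exponents) → inRangeᵇ B k j ≡ true →
  boundedᵇ (positions B) (xpow k j v) e ≡ (v <ᵇ suc (e k j))
boundedᵇ-xpow B k j v e inRange with v <ᵇ suc (e k j) in v≤e
... | true  = all-true⁺ {xs = positions B} (All.tabulate (λ {p} _ → bounded (proj₁ p) (proj₂ p)))
  where
  bounded : ∀ a b → (xpow k j v a b <ᵇ suc (e a b)) ≡ true
  bounded a b with keyEqᵇ (k , j) (a , b) in kj≡ab
  bounded a b | true with keyEqᵇ-sound {k , j} {a , b} kj≡ab
  ... | refl = v≤e
  bounded a b | false = refl
... | false = all-false⁺ (∈-positions⁺ {B} inRange) (trans (cong (_<ᵇ suc (e k j)) (xpow-here k j v)) v≤e)

-- the coefficient of x^t in x_{k,j}^v · G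
xpow-⊛-coefficient : ∀ G → WellDefined G → ∀ B t k j v →
  ∑ (below (positions B) (expo (mono B t)))
    (λ ν → 𝟙 (inRangeᵇ B k j ∧ agreeᵇ (positions B) (expo (mono B ν)) (xpow k j v)) * G (mono B (λ a b → expo (mono B t) a b ∸ ν a b)))
  ≡ 𝟙 (dividesᵇ B k j v t) * G (mono B (quotient B k j v t))
xpow-⊛-coefficient G G-wd B t k j v with inRangeᵇ B k j in inRange
... | false = ∑-zero (λ _ → refl) (below (positions B) (expo (mono B t)))
... | true  =
  trans (∑-cong (λ ν → cong (λ b → 𝟙 b * H ν) (all-cong-∈ (λ {p} p∈ → cong (_≡ᵇ xpow k j v (proj₁ p) (proj₂ p))
                                                                 (expo-∈-positions B ν p∈))))
                (below (positions B) (expo (mono B t))))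
  (trans (∑-below-δ (positions B) (positions-unique B) (expo (mono B t)) (xpow k j v) H H-resp)
         (cong (λ b → 𝟙 b * H (xpow k j v))
               (trans (boundedᵇ-xpow B k j v (expo (mono B t)) inRange)
                      (cong (λ x → v <ᵇ suc x) (expo-inRange B t inRange)))))
  where
  H : Exponents → ℕ
  H ν = G (mono B (λ a b → expo (mono B t) a b ∸ ν a b))
  H-resp : ∀ ν ν′ → AgreeOn (positions B) ν ν′ → H ν ≡ H ν′
  H-resp ν ν′ agree = G-wd B _ _ (λ a b → if-then-0-cong (inRangeᵇ B a b)
                        (λ ab∈ → cong (_ ∸_) (All.lookup agree (∈-positions⁺ {B} {a} {b} ab∈))))

Pstack-⊛ : ∀ d m → 0 < d → ∀ G → WellDefined G → ∀ B t →
  (Pstack (d , suc m) ⊛ G) (mono B t) ≡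
  ∑ (divisorPairs d) (λ kq → proj₁ kq * ∑ (from1 B) (λ j →
     𝟙 (dividesᵇ B (proj₁ kq) j (proj₂ kq * suc m) t) * G (mono B (quotient B (proj₁ kq) j (proj₂ kq * suc m) t))))
Pstack-⊛ d m 0<d G G-wd B t =
  begin
    ∑ BL (λ ν → Pstack (d , suc m) (mono B ν) * H ν)
  ≡⟨ ∑-cong (λ ν → cong (_* H ν) (Pstack-coefficient d m B ν 0<d)) BL ⟩
    ∑ BL (λ ν → ∑ DP (λ kq → proj₁ kq * ∑ (from1 B) (λ j → I kq j ν)) * H ν)
  ≡⟨ ∑-cong (λ ν → trans (sym (∑-*ʳ (H ν) DP _))
                         (∑-cong (λ kq → trans (*-assoc (proj₁ kq) _ (H ν))
                                               (cong (proj₁ kq *_) (sym (∑-*ʳ (H ν) (from1 B) _)))) DP)) BL ⟩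
    ∑ BL (λ ν → ∑ DP (λ kq → proj₁ kq * ∑ (from1 B) (λ j → I kq j ν * H ν)))
  ≡⟨ ∑-comm BL DP _ ⟩
    ∑ DP (λ kq → ∑ BL (λ ν → proj₁ kq * ∑ (from1 B) (λ j → I kq j ν * H ν)))
  ≡⟨ ∑-cong (λ kq → trans (∑-*ˡ (proj₁ kq) BL _) (cong (proj₁ kq *_) (∑-comm BL (from1 B) _))) DP ⟩
    ∑ DP (λ kq → proj₁ kq * ∑ (from1 B) (λ j → ∑ BL (λ ν → I kq j ν * H ν)))
  ≡⟨ ∑-cong (λ kq → cong (proj₁ kq *_) (∑-cong (λ j → xpow-⊛-coefficient G G-wd B t (proj₁ kq) j (proj₂ kq * suc m)) (from1 B))) DP ⟩
    ∑ DP (λ kq → proj₁ kq * ∑ (from1 B) (λ j →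
       𝟙 (dividesᵇ B (proj₁ kq) j (proj₂ kq * suc m) t) * G (mono B (quotient B (proj₁ kq) j (proj₂ kq * suc m) t))))
  ∎
  where
  open ≡-Reasoning
  BL = below (positions B) (expo (mono B t))
  DP = divisorPairs d
  H : Exponents → ℕ
  H ν = G (mono B (λ a b → expo (mono B t) a b ∸ ν a b))
  I : ℕ × ℕ → ℕ → Exponents → ℕ
  I kq j ν = 𝟙 (inRangeᵇ B (proj₁ kq) j ∧ agreeᵇ (positions B) (expo (mono B ν)) (xpow (proj₁ kq) j (proj₂ kq * suc m)))

-- Expanding P_τ into factorizations

-- factorizations B ((k₁,v₁) ∷ … ∷ (k_r,v_r)) t is the number of (j₁,…,j_r) with
-- x^t = x_{k₁,j₁}^{v₁} ⋯ x_{k_r,j_r}^{v_r}.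
factorizations : ℕ → List (ℕ × ℕ) → Exponents → ℕ
factorizations B []              t = oneS (mono B t)
factorizations B ((k , v) ∷ kvs) t =
  ∑ (from1 B) (λ j → 𝟙 (dividesᵇ B k j v t) * factorizations B kvs (quotient B k j v t))

PositiveStacks : List Stack → Set
PositiveStacks τ = All (λ s → 0 < deg s × 0 < mult s) τ

divisorChoices : List Stack → List (List (ℕ × ℕ))
divisorChoices τ = choices (map (λ s → divisorPairs (deg s)) τ)

-- the stacks of D(τ,k), one per stack of τ
divisorStacks : List Stack → List (ℕ × ℕ) → List (ℕ × ℕ)
divisorStacks τ ks = zipWith (λ s kq → (proj₁ kq , proj₂ kq * mult s)) τ ks

P-factorizations : ∀ τ → PositiveStacks τ → ∀ B t → P τ (mono B t) ≡
  ∑ (divisorChoices τ) (λ ks → product (map proj₁ ks) * factorizations B (divisorStacks τ ks) t)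
P-factorizations []                []                 B t = sym (trans (+-identityʳ _) (+-identityʳ _))
P-factorizations ((d , suc m) ∷ τ) ((0<d , _) ∷ pos) B t =
  begin
    (Pstack (d , suc m) ⊛ P τ) (mono B t)
  ≡⟨ Pstack-⊛ d m 0<d (P τ) (P-wellDefined τ) B t ⟩
    ∑ DP (λ kq → proj₁ kq * ∑ (from1 B) (λ j → I kq j * P τ (mono B (t′ kq j))))
  ≡⟨ ∑-cong (λ kq → cong (proj₁ kq *_) (∑-cong (λ j → cong (I kq j *_) (P-factorizations τ pos B (t′ kq j))) (from1 B))) DP ⟩
    ∑ DP (λ kq → proj₁ kq * ∑ (from1 B) (λ j → I kq j * ∑ C (λ ks → Π ks * factorizations B (divisorStacks τ ks) (t′ kq j))))
  ≡⟨ ∑-cong (λ kq → ∑-*-∑-interchange (proj₁ kq) (from1 B) C (I kq) Π (λ ks j → factorizations B (divisorStacks τ ks) (t′ kq j))) DP ⟩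
    ∑ DP (λ kq → ∑ C (λ ks → (proj₁ kq * Π ks) * factorizations B ((proj₁ kq , proj₂ kq * suc m) ∷ divisorStacks τ ks) t))
  ≡⟨ sym (∑-choices DP (map (λ s → divisorPairs (deg s)) τ) _) ⟩
    ∑ (divisorChoices ((d , suc m) ∷ τ)) (λ ks → Π ks * factorizations B (divisorStacks ((d , suc m) ∷ τ) ks) t)
  ∎
  where
  open ≡-Reasoning
  DP = divisorPairs d
  C  = divisorChoices τ
  Π : List (ℕ × ℕ) → ℕ
  Π ks = product (map proj₁ ks)
  I : ℕ × ℕ → ℕ → ℕ
  I kq j = 𝟙 (dividesᵇ B (proj₁ kq) j (proj₂ kq * suc m) t)
  t′ : ℕ × ℕ → ℕ → Exponents
  t′ kq j = quotient B (proj₁ kq) j (proj₂ kq * suc m) t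

-- Counting matrices row by row

rowCandidates : ℕ → ℕ → List Stack → List (List ℕ)
rowCandidates L u β = filterᵇ (λ r → isPermᵇ r (restrict β u ++ replicate (L ∸ length (restrict β u)) 0))
                              (choices (replicate L (upTo (suc (sum (restrict β u))))))

-- sCount α βs u is matrixCount (length (restrict α u)) (restrict α u) βs u by definition
matrixCount : ℕ → List ℕ → List (List Stack) → ℕ → ℕ
matrixCount L T βs u = count (λ rows → eqListᵇ (colSums L rows) T) (choices (map (rowCandidates L u) βs))

leqListᵇ : List ℕ → List ℕ → Bool
leqListᵇ []      []      = true
leqListᵇ (a ∷ r) (b ∷ T) = (a <ᵇ suc b) ∧ leqListᵇ r T
leqListᵇ _       _       = false

subList : List ℕ → List ℕ → List ℕ
subList T r = zipWith _∸_ T r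

eqListᵇ-+-split : ∀ r c T → length r ≡ length T → length c ≤ length T →
  eqListᵇ (zipWith _+_ r c) T ≡ (leqListᵇ r T ∧ eqListᵇ c (subList T r))
eqListᵇ-+-split []      []      []      _ _ = refl
eqListᵇ-+-split (a ∷ r) []      (b ∷ T) _ _ = sym (∧-zeroʳ _)
eqListᵇ-+-split (a ∷ r) (x ∷ c) (b ∷ T) e (s≤s c≤T) =
  trans (cong₂ _∧_ (+≡ᵇ-split a x b) (eqListᵇ-+-split r c T (suc-injective e) c≤T))
        (∧-CS.interchange (a <ᵇ suc b) (x ≡ᵇ b ∸ a) (leqListᵇ r T) (eqListᵇ c (subList T r)))

length-colSums≤ : ∀ L rows → length (colSums L rows) ≤ L
length-colSums≤ L []         = ≤-reflexive (length-replicate L)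
length-colSums≤ L (r ∷ rows) = ≤-trans (length-zipWith≤ʳ _+_ r (colSums L rows)) (length-colSums≤ L rows)

length-∈-rowCandidates : ∀ L u β {r} → r ∈ rowCandidates L u β → length r ≡ L
length-∈-rowCandidates L u β r∈ =
  length-∈-choices-replicate L _ (proj₁ (∈-filterᵇ⁻ _ (choices (replicate L (upTo (suc (sum (restrict β u)))))) r∈))

matrixCount-∷ : ∀ L T β βs u → length T ≡ L →
  matrixCount L T (β ∷ βs) u ≡ ∑ (rowCandidates L u β) (λ r → 𝟙 (leqListᵇ r T) * matrixCount L (subList T r) βs u)
matrixCount-∷ L T β βs u refl =
  trans (count≡∑𝟙 _ (choices (rowCandidates L u β ∷ map (rowCandidates L u) βs)))
  (trans (∑-choices (rowCandidates L u β) (map (rowCandidates L u) βs) _)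
         (∑-cong-∈ (λ {r} r∈ → trans (∑-cong (λ rows → split r r∈ rows) C)
                                      (trans (∑-*ˡ (𝟙 (leqListᵇ r T)) C _)
                                             (cong (𝟙 (leqListᵇ r T) *_) (sym (count≡∑𝟙 _ C)))))))
  where
  C = choices (map (rowCandidates L u) βs)
  split : ∀ r → r ∈ rowCandidates L u β → ∀ rows →
    𝟙 (eqListᵇ (zipWith _+_ r (colSums L rows)) T) ≡ 𝟙 (leqListᵇ r T) * 𝟙 (eqListᵇ (colSums L rows) (subList T r))
  split r r∈ rows = trans (cong 𝟙 (eqListᵇ-+-split r (colSums L rows) T (length-∈-rowCandidates L u β r∈)
                                                   (length-colSums≤ L rows)))
                          (𝟙-∧ (leqListᵇ r T) _)

isPermᵇ-refl : ∀ xs → isPermᵇ xs xs ≡ true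
isPermᵇ-refl xs = all-true⁺ {xs = xs ++ xs} (All.tabulate (λ {w} _ → ≡ᵇ-refl (occ w xs)))

rowCandidates-otherDegree : ∀ L u k v → u ≢ k → rowCandidates L u ((k , v) ∷ []) ≡ replicate L 0 ∷ []
rowCandidates-otherDegree L u k v u≢k
  rewrite ≡ᵇ-false (u≢k ∘ sym) | choices-replicate-zero L | isPermᵇ-refl (replicate L 0) = refl

leqListᵇ-zeros : ∀ T → leqListᵇ (replicate (length T) 0) T ≡ true
leqListᵇ-zeros []      = refl
leqListᵇ-zeros (x ∷ T) = leqListᵇ-zeros T

subList-zeros : ∀ T → subList T (replicate (length T) 0) ≡ T
subList-zeros []      = refl
subList-zeros (x ∷ T) = cong (x ∷_) (subList-zeros T)

matrixCount-otherDegree : ∀ T k v βs u → u ≢ k →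
  matrixCount (length T) T (((k , v) ∷ []) ∷ βs) u ≡ matrixCount (length T) T βs u
matrixCount-otherDegree T k v βs u u≢k =
  begin
    matrixCount (length T) T (((k , v) ∷ []) ∷ βs) u
  ≡⟨ matrixCount-∷ (length T) T ((k , v) ∷ []) βs u refl ⟩
    ∑ (rowCandidates (length T) u ((k , v) ∷ [])) (λ r → 𝟙 (leqListᵇ r T) * matrixCount (length T) (subList T r) βs u)
  ≡⟨ cong (λ rs → ∑ rs (λ r → 𝟙 (leqListᵇ r T) * matrixCount (length T) (subList T r) βs u))
          (rowCandidates-otherDegree (length T) u k v u≢k) ⟩
    𝟙 (leqListᵇ (replicate (length T) 0) T) * matrixCount (length T) (subList T (replicate (length T) 0)) βs u + 0
  ≡⟨ cong₂ (λ b T′ → 𝟙 b * matrixCount (length T) T′ βs u + 0) (leqListᵇ-zeros T) (subList-zeros T) ⟩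
    matrixCount (length T) T βs u + 0 + 0
  ≡⟨ trans (+-identityʳ _) (+-identityʳ _) ⟩
    matrixCount (length T) T βs u
  ∎
  where open ≡-Reasoning

-- Terms: monomials as lists of factors ((d , j) , m) standing for x_{d,j}^m

Factor : Set
Factor = (ℕ × ℕ) × ℕ

degOf indexOf : Factor → ℕ
degOf   z = proj₁ (proj₁ z)
indexOf z = proj₂ (proj₁ z)

keys : Term → List (ℕ × ℕ)
keys = map proj₁

vals : Term → List ℕ
vals = map proj₂

lowerAt : ℕ × ℕ → ℕ → Factor → Factor
lowerAt key v z = if keyEqᵇ (proj₁ z) key then (proj₁ z , proj₂ z ∸ v) else z

lower : ℕ × ℕ → ℕ → Term → Term
lower key v = map (lowerAt key v)

ofDegree : ℕ → Term → Term
ofDegree u = filterᵇ (λ z → degOf z ≡ᵇ u)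

-- the analogue of restrict for terms
multiplicities : Term → ℕ → List ℕ
multiplicities Z u = vals (ofDegree u Z)

lowerAt-key : ∀ key v z → proj₁ (lowerAt key v z) ≡ proj₁ z
lowerAt-key key v z with keyEqᵇ (proj₁ z) key
... | true  = refl
... | false = refl

lowerAt-elsewhere : ∀ key v z → proj₁ z ≢ key → lowerAt key v z ≡ z
lowerAt-elsewhere key v z ne rewrite keyEqᵇ-false ne = refl

lowerAt-here : ∀ z v → proj₂ (lowerAt (proj₁ z) v z) ≡ proj₂ z ∸ v
lowerAt-here z v rewrite keyEqᵇ-refl (proj₁ z) = refl

lower-∉ : ∀ key v Z → All (λ z → proj₁ z ≢ key) Z → lower key v Z ≡ Z
lower-∉ key v []       []         = refl
lower-∉ key v (z ∷ Z) (ne ∷ nes) = cong₂ _∷_ (lowerAt-elsewhere key v z ne) (lower-∉ key v Z nes)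

keys-lower : ∀ key v Z → keys (lower key v Z) ≡ keys Z
keys-lower key v []      = refl
keys-lower key v (z ∷ Z) = cong₂ _∷_ (lowerAt-key key v z) (keys-lower key v Z)

All-lower : ∀ (Q : ℕ × ℕ → Set) key v Z → All (Q ∘ proj₁) Z → All (Q ∘ proj₁) (lower key v Z)
All-lower Q key v []      []       = []
All-lower Q key v (z ∷ Z) (q ∷ qs) = subst Q (sym (lowerAt-key key v z)) q ∷ All-lower Q key v Z qs

∉-keys : ∀ {k} Z → All (k ≢_) (keys Z) → All (λ z → proj₁ z ≢ k) Z
∉-keys []      []         = []
∉-keys (z ∷ Z) (ne ∷ nes) = (ne ∘ sym) ∷ ∉-keys Z nes

keys-unique⇒unique : ∀ Z → Unique (keys Z) → Unique Z
keys-unique⇒unique []      []             = []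
keys-unique⇒unique (z ∷ Z) (z∉Z ∷ uniq) =
  All.tabulate (λ {y} y∈Z z≡y → All.lookup z∉Z (∈-map⁺ proj₁ y∈Z) (cong proj₁ z≡y)) ∷ keys-unique⇒unique Z uniq

keys-filterᵇ-unique : ∀ (p : Factor → Bool) Z → Unique (keys Z) → Unique (keys (filterᵇ p Z))
keys-filterᵇ-unique p []      []             = []
keys-filterᵇ-unique p (z ∷ Z) (z∉Z ∷ uniq) with p z
... | true  = All.tabulate fresh ∷ keys-filterᵇ-unique p Z uniq
  where
  fresh : ∀ {k} → k ∈ keys (filterᵇ p Z) → proj₁ z ≢ k
  fresh k∈ with ∈-map⁻ proj₁ k∈
  ... | y , y∈ , refl = All.lookup z∉Z (∈-map⁺ proj₁ (proj₁ (∈-filterᵇ⁻ p Z y∈)))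
... | false = keys-filterᵇ-unique p Z uniq

indices-ofDegree-unique : ∀ k Z → Unique (keys Z) → Unique (map indexOf (ofDegree k Z))
indices-ofDegree-unique k []      []             = []
indices-ofDegree-unique k (z ∷ Z) (z∉Z ∷ uniq) with degOf z ≡ᵇ k in deg-z
... | true  = All.tabulate fresh ∷ indices-ofDegree-unique k Z uniq
  where
  fresh : ∀ {j} → j ∈ map indexOf (ofDegree k Z) → indexOf z ≢ j
  fresh j∈ z≡j with ∈-map⁻ indexOf j∈
  ... | y , y∈ , refl with ∈-filterᵇ⁻ (λ z → degOf z ≡ᵇ k) Z y∈
  ... | y∈Z , deg-y = All.lookup z∉Z (∈-map⁺ proj₁ y∈Z)
                        (cong₂ _,_ (trans (≡ᵇ-sound deg-z) (sym (≡ᵇ-sound deg-y))) z≡j)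
... | false = indices-ofDegree-unique k Z uniq

multiplicities-lower : ∀ key v Z u → multiplicities (lower key v Z) u ≡ vals (lower key v (ofDegree u Z))
multiplicities-lower key v Z u =
  cong vals (filterᵇ-map-comm _ (lowerAt key v) (λ z → cong (λ p → proj₁ p ≡ᵇ u) (lowerAt-key key v z)) Z)

multiplicities-lower-otherDegree : ∀ k j v Z u → u ≢ k → multiplicities (lower (k , j) v Z) u ≡ multiplicities Z u
multiplicities-lower-otherDegree k j v Z u u≢k =
  trans (multiplicities-lower (k , j) v Z u) (cong vals (lower-∉ (k , j) v (ofDegree u Z) (All.tabulate other)))
  where
  other : ∀ {z} → z ∈ ofDegree u Z → proj₁ z ≢ (k , j)
  other z∈ e = u≢k (trans (sym (≡ᵇ-sound (proj₂ (∈-filterᵇ⁻ (λ z → degOf z ≡ᵇ u) Z z∈)))) (cong proj₁ e))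

length-vals-lower : ∀ key v W → length (vals (lower key v W)) ≡ length (vals W)
length-vals-lower key v W = trans (length-map proj₂ (lower key v W)) (trans (length-map (lowerAt key v) W) (sym (length-map proj₂ W)))

termExp-∉ : ∀ Z a b → All (λ z → proj₁ z ≢ (a , b)) Z → termExp Z a b ≡ 0
termExp-∉ []      a b []         = refl
termExp-∉ (z ∷ Z) a b (ne ∷ nes) rewrite keyEqᵇ-false ne = termExp-∉ Z a b nes

termExp-∈ : ∀ Z → Unique (keys Z) → ∀ {z} → z ∈ Z → termExp Z (degOf z) (indexOf z) ≡ proj₂ z
termExp-∈ (w ∷ Z) (w∉Z ∷ uniq) (here refl)
  rewrite keyEqᵇ-refl (proj₁ w) | termExp-∉ Z (degOf w) (indexOf w) (∉-keys Z w∉Z) = +-identityʳ _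
termExp-∈ (w ∷ Z) (w∉Z ∷ uniq) {z} (there z∈)
  rewrite keyEqᵇ-false (λ e → All.lookup w∉Z (∈-map⁺ proj₁ z∈) e) = termExp-∈ Z uniq z∈

termExp≢0⇒∈ : ∀ Z a b → termExp Z a b ≢ 0 → Any (λ z → proj₁ z ≡ (a , b)) Z
termExp≢0⇒∈ []      a b h = ⊥-elim (h refl)
termExp≢0⇒∈ (z ∷ Z) a b h with keyEqᵇ (proj₁ z) (a , b) in e
... | true  = here (keyEqᵇ-sound e)
... | false = there (termExp≢0⇒∈ Z a b h)

termExp-zero : ∀ Z → All (λ z → (proj₂ z ≡ᵇ 0) ≡ true) Z → ∀ a b → termExp Z a b ≡ 0
termExp-zero []      []       a b = refl
termExp-zero (z ∷ Z) (h ∷ hs) a b rewrite termExp-zero Z hs a b | ≡ᵇ-sound {proj₂ z} h with keyEqᵇ (proj₁ z) (a , b)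
... | true  = refl
... | false = refl

termExp-lower : ∀ Z → Unique (keys Z) → ∀ {z} → z ∈ Z → ∀ v a b →
  termExp (lower (proj₁ z) v Z) a b ≡ termExp Z a b ∸ xpow (degOf z) (indexOf z) v a b
termExp-lower Z uniq {z} z∈ v a b with ≡-dec _≟_ _≟_ (proj₁ z) (a , b)
... | yes refl =
  trans (subst (λ q → termExp (lower (proj₁ z) v Z) (proj₁ q) (proj₂ q) ≡ proj₂ (lowerAt (proj₁ z) v z)) (lowerAt-key (proj₁ z) v z)
               (termExp-∈ (lower (proj₁ z) v Z) (subst Unique (sym (keys-lower (proj₁ z) v Z)) uniq) (∈-map⁺ (lowerAt (proj₁ z) v) z∈)))
        (trans (lowerAt-here z v) (sym (cong₂ _∸_ (termExp-∈ Z uniq z∈) (xpow-here (degOf z) (indexOf z) v))))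
... | no z≢ab rewrite keyEqᵇ-false z≢ab = unchanged Z
  where
  unchanged : ∀ Z′ → termExp (lower (proj₁ z) v Z′) a b ≡ termExp Z′ a b
  unchanged []       = refl
  unchanged (w ∷ Z′) = cong₂ _+_ (at w) (unchanged Z′)
    where
    at : ∀ w → (if keyEqᵇ (proj₁ (lowerAt (proj₁ z) v w)) (a , b) then proj₂ (lowerAt (proj₁ z) v w) else 0)
             ≡ (if keyEqᵇ (proj₁ w) (a , b) then proj₂ w else 0)
    at w with keyEqᵇ (proj₁ w) (proj₁ z) in w≡z
    ... | false = refl
    ... | true rewrite keyEqᵇ-false {proj₁ w} {a , b} (z≢ab ∘ trans (sym (keyEqᵇ-sound w≡z))) = refl

allZeroᵇ : List ℕ → Bool
allZeroᵇ r = all (_≡ᵇ 0) r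

isUnitᵇ : ℕ → List ℕ → Bool
isUnitᵇ v []      = false
isUnitᵇ v (x ∷ r) = ((x ≡ᵇ 0) ∧ isUnitᵇ v r) ∨ ((x ≡ᵇ v) ∧ allZeroᵇ r)

occ-∷ : ∀ w x xs → occ w (x ∷ xs) ≡ 𝟙 (x ≡ᵇ w) + occ w xs
occ-∷ w x xs with x ≡ᵇ w
... | true  = refl
... | false = refl

occ-∉ : ∀ w xs → ¬ (w ∈ xs) → occ w xs ≡ 0
occ-∉ w []       _   = refl
occ-∉ w (x ∷ xs) w∉ rewrite occ-∷ w x xs | ≡ᵇ-false {x} {w} (λ e → w∉ (here (sym e))) = occ-∉ w xs (w∉ ∘ there)

occ-∈ : ∀ w xs → w ∈ xs → 0 < occ w xs
occ-∈ w (x ∷ xs) (here refl) rewrite occ-∷ x x xs | ≡ᵇ-refl x = s≤s z≤n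
occ-∈ w (x ∷ xs) (there w∈)  rewrite occ-∷ w x xs = ≤-trans (occ-∈ w xs w∈) (m≤n+m _ _)

occ>0⇒∈ : ∀ w xs → 0 < occ w xs → w ∈ xs
occ>0⇒∈ w xs occ>0 with w ∈? xs
... | yes w∈ = w∈
... | no  w∉ = ⊥-elim (<⇒≢ occ>0 (sym (occ-∉ w xs w∉)))

isPermᵇ⁺ : ∀ xs ys → (∀ w → occ w xs ≡ occ w ys) → isPermᵇ xs ys ≡ true
isPermᵇ⁺ xs ys h =
  all-true⁺ {xs = xs ++ ys} (All.tabulate (λ {w} _ → subst (λ n → (occ w xs ≡ᵇ n) ≡ true) (h w) (≡ᵇ-refl (occ w xs))))

isPermᵇ⁻ : ∀ xs ys → isPermᵇ xs ys ≡ true → ∀ w → occ w xs ≡ occ w ys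
isPermᵇ⁻ xs ys h w with w ∈? (xs ++ ys)
... | yes w∈ = ≡ᵇ-sound (All.lookup (all-true⁻ (xs ++ ys) h) w∈)
... | no  w∉ = trans (occ-∉ w xs (w∉ ∘ ∈-++⁺ˡ)) (sym (occ-∉ w ys (w∉ ∘ ∈-++⁺ʳ xs)))

allZeroᵇ⇒replicate : ∀ r → allZeroᵇ r ≡ true → r ≡ replicate (length r) 0
allZeroᵇ⇒replicate []      _ = refl
allZeroᵇ⇒replicate (x ∷ r) h with ∧-true⁻ {x ≡ᵇ 0} h
... | x≡0 , rest = cong₂ _∷_ (≡ᵇ-sound x≡0) (allZeroᵇ⇒replicate r rest)

occ-replicate-zero : ∀ v n → 0 < v → occ v (replicate n 0) ≡ 0
occ-replicate-zero v zero    _   = refl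
occ-replicate-zero v (suc n) 0<v rewrite occ-∷ v 0 (replicate n 0) | ≡ᵇ-false {0} {v} (<⇒≢ 0<v) = occ-replicate-zero v n 0<v

mutual
  unitᵇ⇒occ : ∀ v x r → isUnitᵇ v (x ∷ r) ≡ true → ∀ w → occ w (x ∷ r) ≡ occ w (v ∷ replicate (length r) 0)
  unitᵇ⇒occ v x r h w with ∨-true⁻ {(x ≡ᵇ 0) ∧ isUnitᵇ v r} h
  ... | inj₁ h′ = zero-head⇒occ v x r (∧-true⁻ h′) w
  ... | inj₂ h′ with ∧-true⁻ {x ≡ᵇ v} h′
  ...   | x≡v , r≡0 = cong₂ (λ a b → occ w (a ∷ b)) (≡ᵇ-sound {x} {v} x≡v) (allZeroᵇ⇒replicate r r≡0)

  zero-head⇒occ : ∀ v x r → (x ≡ᵇ 0) ≡ true × isUnitᵇ v r ≡ true →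
    ∀ w → occ w (x ∷ r) ≡ occ w (v ∷ replicate (length r) 0)
  zero-head⇒occ v x (y ∷ r) (x≡0 , unit) w
    rewrite ≡ᵇ-sound {x} x≡0 | occ-∷ w 0 (y ∷ r) | unitᵇ⇒occ v y r unit w
          | occ-∷ w v (replicate (length r) 0) | occ-∷ w v (0 ∷ replicate (length r) 0)
          | occ-∷ w 0 (replicate (length r) 0) = +-CS.x∙yz≈y∙xz (𝟙 (0 ≡ᵇ w)) (𝟙 (v ≡ᵇ w)) _

occ⇒unitᵇ : ∀ v r → 0 < v → (∀ w → occ w r ≡ occ w (v ∷ replicate (length r ∸ 1) 0)) → isUnitᵇ v r ≡ true
occ⇒unitᵇ v r 0<v h = unit r (All.tabulate zero-or-v) occ-v
  where
  zero-or-v : ∀ {x} → x ∈ r → x ≡ 0 ⊎ x ≡ v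
  zero-or-v {x} x∈ with occ>0⇒∈ x (v ∷ replicate (length r ∸ 1) 0) (subst (0 <_) (h x) (occ-∈ x r x∈))
  ... | here x≡v   = inj₂ x≡v
  ... | there x∈0s = inj₁ (All.lookup (All.replicate⁺ {P = _≡ 0} (length r ∸ 1) refl) x∈0s)
  occ-v : occ v r ≡ 1
  occ-v rewrite h v | occ-∷ v v (replicate (length r ∸ 1) 0) | ≡ᵇ-refl v | occ-replicate-zero v (length r ∸ 1) 0<v = refl
  allZero : ∀ {ys} → All (λ y → y ≡ 0 ⊎ y ≡ v) ys → occ v ys ≡ 0 → allZeroᵇ ys ≡ true
  allZero []                  _ = refl
  allZero {y ∷ ys} (inj₁ refl ∷ rest) o rewrite occ-∷ v 0 ys | ≡ᵇ-false {0} {v} (<⇒≢ 0<v) = allZero rest o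
  allZero {y ∷ ys} (inj₂ refl ∷ rest) o rewrite occ-∷ y y ys | ≡ᵇ-refl y = ⊥-elim (1+n≢0 o)
  unit : ∀ ys → All (λ y → y ≡ 0 ⊎ y ≡ v) ys → occ v ys ≡ 1 → isUnitᵇ v ys ≡ true
  unit (y ∷ ys) (inj₁ refl ∷ rest) o
    rewrite occ-∷ v 0 ys | ≡ᵇ-false {0} {v} (<⇒≢ 0<v) | unit ys rest o = refl
  unit (y ∷ ys) (inj₂ refl ∷ rest) o
    rewrite occ-∷ y y ys | ≡ᵇ-refl y | allZero rest (suc-injective o) | ∨-zeroʳ ((y ≡ᵇ 0) ∧ isUnitᵇ y ys) = refl

isPermᵇ-unit : ∀ v r → 0 < v → isPermᵇ r (v ∷ replicate (length r ∸ 1) 0) ≡ isUnitᵇ v r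
isPermᵇ-unit v r 0<v with isUnitᵇ v r in unit
isPermᵇ-unit v (x ∷ r) 0<v | true = isPermᵇ⁺ (x ∷ r) _ (unitᵇ⇒occ v x r unit)
isPermᵇ-unit v r 0<v | false with isPermᵇ r (v ∷ replicate (length r ∸ 1) 0) in perm
... | false = refl
... | true  = ⊥-elim (false≢true (trans (sym unit) (occ⇒unitᵇ v r 0<v (isPermᵇ⁻ r _ perm))))

unitCandidates : ℕ → ℕ → List (List ℕ)
unitCandidates v L = filterᵇ (λ r → isPermᵇ r (v ∷ replicate (L ∸ 1) 0)) (choices (replicate L (upTo (suc (v + 0)))))

rowCandidates-sameDegree : ∀ L k v → rowCandidates L k ((k , v) ∷ []) ≡ unitCandidates v L
rowCandidates-sameDegree L k v rewrite ≡ᵇ-refl k = refl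

matrixCount-sameDegree : ∀ T k v βs → matrixCount (length T) T (((k , v) ∷ []) ∷ βs) k ≡
  ∑ (unitCandidates v (length T)) (λ r → 𝟙 (leqListᵇ r T) * matrixCount (length T) (subList T r) βs k)
matrixCount-sameDegree T k v βs =
  trans (matrixCount-∷ (length T) T ((k , v) ∷ []) βs k refl)
        (cong (λ rs → ∑ rs (λ r → 𝟙 (leqListᵇ r T) * matrixCount (length T) (subList T r) βs k))
              (rowCandidates-sameDegree (length T) k v))

module UnitRows (v : ℕ) (0<v : 0 < v) where

  entries : List ℕ
  entries = upTo (suc (v + 0))

  0∈entries : 0 ∈ entries
  0∈entries = ∈-upTo⁺ (s≤s z≤n)

  v∈entries : v ∈ entries
  v∈entries = ∈-upTo⁺ (s≤s (≤-reflexive (sym (+-identityʳ v))))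

  ∑units : ℕ → (List ℕ → ℕ) → ℕ
  ∑units L G = ∑ (choices (replicate L entries)) (λ r → 𝟙 (isUnitᵇ v r) * G r)

  ∑-unitCandidates : ∀ L G → ∑ (unitCandidates v L) G ≡ ∑units L G
  ∑-unitCandidates L G = trans (∑-filter _ (choices (replicate L entries)) G)
    (∑-cong-∈ (λ {r} r∈ → cong (λ b → 𝟙 b * G r)
      (trans (cong (λ l → isPermᵇ r (v ∷ replicate (l ∸ 1) 0)) (sym (length-∈-choices-replicate L entries r∈)))
             (isPermᵇ-unit v r 0<v))))

  ∑-allZero : ∀ L (H : List ℕ → ℕ) → ∑ (choices (replicate L entries)) (λ r → 𝟙 (allZeroᵇ r) * H r) ≡ H (replicate L 0)
  ∑-allZero zero    H = trans (+-identityʳ _) (+-identityʳ _)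
  ∑-allZero (suc L) H =
    trans (∑-choices entries (replicate L entries) _)
    (trans (∑-cong (λ x → trans (∑-cong (λ r → 𝟙-∧-* (x ≡ᵇ 0) (allZeroᵇ r) (H (x ∷ r))) (choices (replicate L entries)))
                                (∑-*ˡ (𝟙 (x ≡ᵇ 0)) (choices (replicate L entries)) _)) entries)
    (trans (∑-δℕ 0∈entries (Unique.upTo⁺ _) _)
           (∑-allZero L (λ r → H (0 ∷ r)))))

  𝟙-isUnitᵇ-∷ : ∀ x r → 𝟙 (isUnitᵇ v (x ∷ r)) ≡ 𝟙 ((x ≡ᵇ 0) ∧ isUnitᵇ v r) + 𝟙 ((x ≡ᵇ v) ∧ allZeroᵇ r)
  𝟙-isUnitᵇ-∷ x r with x ≡ᵇ 0 in x≡0 | x ≡ᵇ v in x≡v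
  ... | true  | true  = ⊥-elim (<⇒≢ 0<v (trans (sym (≡ᵇ-sound {x} x≡0)) (≡ᵇ-sound x≡v)))
  ... | true  | false with isUnitᵇ v r
  ...   | true  = refl
  ...   | false = refl
  𝟙-isUnitᵇ-∷ x r | false | true  = refl
  𝟙-isUnitᵇ-∷ x r | false | false = refl

  -- a unit row starts either with 0 followed by a unit row, or with v followed by zeros
  ∑units-suc : ∀ L G → ∑units (suc L) G ≡ ∑units L (λ r → G (0 ∷ r)) + G (v ∷ replicate L 0)
  ∑units-suc L G =
    begin
      ∑units (suc L) G
    ≡⟨ ∑-choices entries (replicate L entries) _ ⟩
      ∑ entries (λ x → ∑ C (λ r → 𝟙 (isUnitᵇ v (x ∷ r)) * G (x ∷ r)))
    ≡⟨ ∑-cong split entries ⟩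
      ∑ entries (λ x → 𝟙 (x ≡ᵇ 0) * ∑units L (λ r → G (x ∷ r)) + 𝟙 (x ≡ᵇ v) * ∑ C (λ r → 𝟙 (allZeroᵇ r) * G (x ∷ r)))
    ≡⟨ ∑-+ entries (λ x → 𝟙 (x ≡ᵇ 0) * ∑units L (λ r → G (x ∷ r))) (λ x → 𝟙 (x ≡ᵇ v) * ∑ C (λ r → 𝟙 (allZeroᵇ r) * G (x ∷ r))) ⟩
      ∑ entries (λ x → 𝟙 (x ≡ᵇ 0) * ∑units L (λ r → G (x ∷ r))) + ∑ entries (λ x → 𝟙 (x ≡ᵇ v) * ∑ C (λ r → 𝟙 (allZeroᵇ r) * G (x ∷ r)))
    ≡⟨ cong₂ _+_ (∑-δℕ 0∈entries (Unique.upTo⁺ _) (λ x → ∑units L (λ r → G (x ∷ r))))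
                 (∑-δℕ v∈entries (Unique.upTo⁺ _) (λ x → ∑ C (λ r → 𝟙 (allZeroᵇ r) * G (x ∷ r)))) ⟩
      ∑units L (λ r → G (0 ∷ r)) + ∑ C (λ r → 𝟙 (allZeroᵇ r) * G (v ∷ r))
    ≡⟨ cong (∑units L (λ r → G (0 ∷ r)) +_) (∑-allZero L (λ r → G (v ∷ r))) ⟩
      ∑units L (λ r → G (0 ∷ r)) + G (v ∷ replicate L 0)
    ∎
    where
    open ≡-Reasoning
    C = choices (replicate L entries)
    split : ∀ x → ∑ C (λ r → 𝟙 (isUnitᵇ v (x ∷ r)) * G (x ∷ r))
                ≡ 𝟙 (x ≡ᵇ 0) * ∑units L (λ r → G (x ∷ r)) + 𝟙 (x ≡ᵇ v) * ∑ C (λ r → 𝟙 (allZeroᵇ r) * G (x ∷ r))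
    split x = begin
        ∑ C (λ r → 𝟙 (isUnitᵇ v (x ∷ r)) * G (x ∷ r))
      ≡⟨ ∑-cong (λ r → trans (cong (_* G (x ∷ r)) (𝟙-isUnitᵇ-∷ x r)) (*-distribʳ-+ (G (x ∷ r)) (𝟙 ((x ≡ᵇ 0) ∧ isUnitᵇ v r)) _)) C ⟩
        ∑ C (λ r → 𝟙 ((x ≡ᵇ 0) ∧ isUnitᵇ v r) * G (x ∷ r) + 𝟙 ((x ≡ᵇ v) ∧ allZeroᵇ r) * G (x ∷ r))
      ≡⟨ ∑-+ C _ _ ⟩
        ∑ C (λ r → 𝟙 ((x ≡ᵇ 0) ∧ isUnitᵇ v r) * G (x ∷ r)) + ∑ C (λ r → 𝟙 ((x ≡ᵇ v) ∧ allZeroᵇ r) * G (x ∷ r))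
      ≡⟨ cong₂ _+_ (trans (∑-cong (λ r → 𝟙-∧-* (x ≡ᵇ 0) _ _) C) (∑-*ˡ (𝟙 (x ≡ᵇ 0)) C _))
                   (trans (∑-cong (λ r → 𝟙-∧-* (x ≡ᵇ v) _ _) C) (∑-*ˡ (𝟙 (x ≡ᵇ v)) C _)) ⟩
        𝟙 (x ≡ᵇ 0) * ∑units L (λ r → G (x ∷ r)) + 𝟙 (x ≡ᵇ v) * ∑ C (λ r → 𝟙 (allZeroᵇ r) * G (x ∷ r))
      ∎

  -- subtracting a unit row from the multiplicities of W is lowering one factor of W by v
  ∑units-lower : ∀ W → Unique (keys W) → (H : List ℕ → ℕ) →
    ∑units (length W) (λ r → 𝟙 (leqListᵇ r (vals W)) * H (subList (vals W) r)) ≡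
    ∑ W (λ z → 𝟙 (v <ᵇ suc (proj₂ z)) * H (vals (lower (proj₁ z) v W)))
  ∑units-lower []      _              H = refl
  ∑units-lower (w ∷ W) (w∉W ∷ uniq) H =
    begin
      ∑units (suc (length W)) (λ r → 𝟙 (leqListᵇ r (vals (w ∷ W))) * H (subList (vals (w ∷ W)) r))
    ≡⟨ ∑units-suc (length W) _ ⟩
      ∑units (length W) (λ r → 𝟙 (leqListᵇ r (vals W)) * H (proj₂ w ∷ subList (vals W) r))
        + 𝟙 ((v <ᵇ suc (proj₂ w)) ∧ leqListᵇ (replicate (length W) 0) (vals W)) * H ((proj₂ w ∸ v) ∷ subList (vals W) (replicate (length W) 0))
    ≡⟨ cong₂ _+_ (∑units-lower W uniq (λ l → H (proj₂ w ∷ l)))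
                 (cong₂ (λ b l → 𝟙 ((v <ᵇ suc (proj₂ w)) ∧ b) * H ((proj₂ w ∸ v) ∷ l)) leq-zeros sub-zeros) ⟩
      ∑ W (λ z → 𝟙 (v <ᵇ suc (proj₂ z)) * H (proj₂ w ∷ vals (lower (proj₁ z) v W)))
        + 𝟙 ((v <ᵇ suc (proj₂ w)) ∧ true) * H ((proj₂ w ∸ v) ∷ vals W)
    ≡⟨ +-comm (∑ W (λ z → 𝟙 (v <ᵇ suc (proj₂ z)) * H (proj₂ w ∷ vals (lower (proj₁ z) v W)))) _ ⟩
      𝟙 ((v <ᵇ suc (proj₂ w)) ∧ true) * H ((proj₂ w ∸ v) ∷ vals W)
        + ∑ W (λ z → 𝟙 (v <ᵇ suc (proj₂ z)) * H (proj₂ w ∷ vals (lower (proj₁ z) v W)))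
    ≡⟨ cong₂ _+_ (cong₂ (λ b l → 𝟙 b * H l) (∧-identityʳ (v <ᵇ suc (proj₂ w))) (sym lower-head))
                 (∑-cong-∈ (λ {z} z∈ → cong (λ y → 𝟙 (v <ᵇ suc (proj₂ z)) * H (proj₂ y ∷ vals (lower (proj₁ z) v W)))
                                            (sym (lowerAt-elsewhere (proj₁ z) v w (All.lookup w∉W (∈-map⁺ proj₁ z∈)))))) ⟩
      𝟙 (v <ᵇ suc (proj₂ w)) * H (vals (lower (proj₁ w) v (w ∷ W)))
        + ∑ W (λ z → 𝟙 (v <ᵇ suc (proj₂ z)) * H (vals (lower (proj₁ z) v (w ∷ W))))
    ∎
    where
    open ≡-Reasoning
    leq-zeros : leqListᵇ (replicate (length W) 0) (vals W) ≡ true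
    leq-zeros = subst (λ l → leqListᵇ (replicate l 0) (vals W) ≡ true) (length-map proj₂ W) (leqListᵇ-zeros (vals W))
    sub-zeros : subList (vals W) (replicate (length W) 0) ≡ vals W
    sub-zeros = subst (λ l → subList (vals W) (replicate l 0) ≡ vals W) (length-map proj₂ W) (subList-zeros (vals W))
    lower-head : vals (lower (proj₁ w) v (w ∷ W)) ≡ (proj₂ w ∸ v) ∷ vals W
    lower-head rewrite keyEqᵇ-refl (proj₁ w) | lower-∉ (proj₁ w) v W (∉-keys W w∉W) = refl

InRange : ℕ → Factor → Set
InRange B z = inRangeᵇ B (degOf z) (indexOf z) ≡ true

record Represents (B : ℕ) (t : Exponents) (Z : Term) : Set where
  field
    keys-unique : Unique (keys Z)
    inRange     : All (InRange B) Z
    exponents   : SameExpo B t (termExp Z)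

  expo≡termExp : ∀ {a b} → inRangeᵇ B a b ≡ true → expo (mono B t) a b ≡ termExp Z a b
  expo≡termExp {a} {b} r = trans (exponents a b) (expo-inRange B (termExp Z) r)

  expo≡proj₂ : ∀ {z} → z ∈ Z → expo (mono B t) (degOf z) (indexOf z) ≡ proj₂ z
  expo≡proj₂ z∈ = trans (expo≡termExp (All.lookup inRange z∈)) (termExp-∈ Z keys-unique z∈)

Represents-lower : ∀ {B t Z} → Represents B t Z → ∀ {z} → z ∈ Z → ∀ v →
  Represents B (quotient B (degOf z) (indexOf z) v t) (lower (proj₁ z) v Z)
Represents-lower {B} {t} {Z} rep {z} z∈ v = record
  { keys-unique = subst Unique (sym (keys-lower (proj₁ z) v Z)) keys-unique
  ; inRange     = All-lower (λ p → inRangeᵇ B (proj₁ p) (proj₂ p) ≡ true) (proj₁ z) v Z inRange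
  ; exponents   = λ a b → if-then-0-cong (inRangeᵇ B a b) (λ r →
      trans (cong (_∸ xpow (degOf z) (indexOf z) v a b) (expo≡termExp r)) (sym (termExp-lower Z keys-unique z∈ v a b)))
  }
  where open Represents rep

allExponentsZeroᵇ : Term → Bool
allExponentsZeroᵇ Z = all (λ z → proj₂ z ≡ᵇ 0) Z

factorizations-[] : ∀ {B t Z} → Represents B t Z → factorizations B [] t ≡ 𝟙 (allExponentsZeroᵇ Z)
factorizations-[] {B} {t} {Z} rep = cong 𝟙 (go (allExponentsZeroᵇ Z) refl)
  where
  open Represents rep
  go : ∀ b → allExponentsZeroᵇ Z ≡ b → all (λ ij → expo (mono B t) (proj₁ ij) (proj₂ ij) ≡ᵇ 0) (positions B) ≡ b
  go true  all-zero = all-true⁺ {xs = positions B} (All.tabulate (λ {p} p∈ → cong (_≡ᵇ 0)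
    (trans (expo≡termExp (∈-positions⁻ {B} p∈)) (termExp-zero Z (all-true⁻ Z all-zero) (proj₁ p) (proj₂ p)))))
  go false nonzero with find (all-false⁻ Z nonzero)
  ... | z , z∈ , z≢0 = all-false⁺ (∈-positions⁺ {B} {degOf z} {indexOf z} (All.lookup inRange z∈))
                                  (trans (cong (_≡ᵇ 0) (expo≡proj₂ z∈)) z≢0)

-- the index j of x_{k,j} ranges over the degree-k factors of the term
factorizations-∷ : ∀ {B t Z} → Represents B t Z → ∀ k v kvs → 0 < v →
  factorizations B ((k , v) ∷ kvs) t ≡
  ∑ (ofDegree k Z) (λ z → 𝟙 (v <ᵇ suc (proj₂ z)) * factorizations B kvs (quotient B k (indexOf z) v t))
factorizations-∷ {B} {t} {Z} rep k v kvs 0<v =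
  trans (∑-reindex (from1 B) F indexOf (ofDegree k Z) (from1-unique B) (indices-ofDegree-unique k Z keys-unique)
                   (All.tabulate index∈) off-image)
        (∑-cong-∈ at)
  where
  open Represents rep
  F : ℕ → ℕ
  F j = 𝟙 (dividesᵇ B k j v t) * factorizations B kvs (quotient B k j v t)
  ofDegree⁻ : ∀ {z} → z ∈ ofDegree k Z → z ∈ Z × (degOf z ≡ᵇ k) ≡ true
  ofDegree⁻ = ∈-filterᵇ⁻ (λ z → degOf z ≡ᵇ k) Z
  index∈ : ∀ {z} → z ∈ ofDegree k Z → indexOf z ∈ from1 B
  index∈ {z} z∈ = proj₂ (inRangeᵇ⁻ {B} {degOf z} (All.lookup inRange (proj₁ (ofDegree⁻ z∈))))
  not-kj : ∀ {j} → ¬ (j ∈ map indexOf (ofDegree k Z)) → ∀ {z} → z ∈ Z → proj₁ z ≢ (k , j)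
  not-kj j∉ z∈ refl = j∉ (∈-map⁺ indexOf (∈-filterᵇ⁺ (λ z → degOf z ≡ᵇ k) Z z∈ (≡ᵇ-refl k)))
  off-image : ∀ {j} → j ∈ from1 B → ¬ (j ∈ map indexOf (ofDegree k Z)) → F j ≡ 0
  off-image {j} _ j∉ = 𝟙-*-false _ (∧-≡false (inRangeᵇ B k j) (λ r →
    trans (cong (λ x → v <ᵇ suc x) (trans (expo≡termExp r) (termExp-∉ Z k j (All.tabulate (not-kj j∉)))))
          (<ᵇ-false {v} {1} (<⇒≢ 0<v ∘ sym ∘ n<1⇒n≡0))))
  at : ∀ {z} → z ∈ ofDegree k Z → F (indexOf z) ≡ 𝟙 (v <ᵇ suc (proj₂ z)) * factorizations B kvs (quotient B k (indexOf z) v t)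
  at {z} z∈ with ofDegree⁻ z∈
  ... | z∈Z , deg-z with ≡ᵇ-sound {degOf z} deg-z
  ... | refl rewrite expo≡proj₂ z∈Z | All.lookup inRange z∈Z = refl

-- 𝒮 for one-stack partitions

-- 𝒮 with the restrictions α|_u read off the term Z
matrixProduct : List ℕ → Term → List (List Stack) → ℕ
matrixProduct R Z βs = product (map (λ u → matrixCount (length (multiplicities Z u)) (multiplicities Z u) βs u) R)

matrixCount-[] : ∀ T u → matrixCount (length T) T [] u ≡ 𝟙 (allZeroᵇ T)
matrixCount-[] T u = trans (count≡∑𝟙 (λ rows → eqListᵇ (colSums (length T) rows) T) ([] ∷ []))
                           (trans (+-identityʳ _) (cong 𝟙 (eqListᵇ-zeros T)))
  where
  eqListᵇ-zeros : ∀ T → eqListᵇ (replicate (length T) 0) T ≡ allZeroᵇ T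
  eqListᵇ-zeros []      = refl
  eqListᵇ-zeros (x ∷ T) = cong₂ _∧_ (≡ᵇ-sym 0 x) (eqListᵇ-zeros T)

matrixProduct-[] : ∀ R Z → All (λ z → degOf z ∈ R) Z → matrixProduct R Z [] ≡ 𝟙 (allExponentsZeroᵇ Z)
matrixProduct-[] R Z degs∈R = trans (cong product (map-cong (λ u → matrixCount-[] (multiplicities Z u) u) R))
                                    (go (allExponentsZeroᵇ Z) refl)
  where
  go : ∀ b → allExponentsZeroᵇ Z ≡ b → product (map (λ u → 𝟙 (allZeroᵇ (multiplicities Z u))) R) ≡ 𝟙 b
  go true all-zero = product-ones (map (λ u → 𝟙 (allZeroᵇ (multiplicities Z u))) R) (All.map⁺ (All.tabulate (λ {u} _ →
    cong 𝟙 (all-true⁺ {xs = multiplicities Z u} (All.tabulate (λ x∈ → zero-entry u x∈))))))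
    where
    zero-entry : ∀ u {x} → x ∈ multiplicities Z u → (x ≡ᵇ 0) ≡ true
    zero-entry u x∈ with ∈-map⁻ proj₂ x∈
    ... | z , z∈ , refl = All.lookup (all-true⁻ Z all-zero) (proj₁ (∈-filterᵇ⁻ _ Z z∈))
  go false nonzero with find (all-false⁻ Z nonzero)
  ... | z , z∈ , z≢0 = product-zero _ (Any.map (λ { refl → cong 𝟙 (all-false⁺ z∈mults z≢0) })
                                                (∈-map⁺ (λ u → 𝟙 (allZeroᵇ (multiplicities Z u))) (All.lookup degs∈R z∈)))
    where
    z∈mults : proj₂ z ∈ multiplicities Z (degOf z)
    z∈mults = ∈-map⁺ proj₂ (∈-filterᵇ⁺ (λ z′ → degOf z′ ≡ᵇ degOf z) Z z∈ (≡ᵇ-refl (degOf z)))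

-- the first row (k^v) is a unit row of degree k; it lowers one degree-k factor by v
matrixProduct-∷ : ∀ R → Unique R → ∀ k v βs Z → k ∈ R → 0 < v → Unique (keys Z) →
  matrixProduct R Z (((k , v) ∷ []) ∷ βs) ≡
  ∑ (ofDegree k Z) (λ z → 𝟙 (v <ᵇ suc (proj₂ z)) * matrixProduct R (lower (proj₁ z) v Z) βs)
matrixProduct-∷ R R-unique k v βs Z k∈R 0<v keys-unique =
  begin
    matrixProduct R Z (((k , v) ∷ []) ∷ βs)
  ≡⟨ cong product (map-cong (λ u → trans (factor u) (cong (λ x → if u ≡ᵇ k then x else G u) (matrixCount-sameDegree Tk k v βs))) R) ⟩
    product (map (λ u → if u ≡ᵇ k then ∑ (unitCandidates v Lk) (λ r → 𝟙 (leqListᵇ r Tk) * matrixCount Lk (subList Tk r) βs k) else G u) R)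
  ≡⟨ product-distrib-∑-at R k k∈R R-unique (unitCandidates v Lk) (λ r → 𝟙 (leqListᵇ r Tk)) (λ r → matrixCount Lk (subList Tk r) βs k) G ⟩
    ∑ (unitCandidates v Lk) (λ r → 𝟙 (leqListᵇ r Tk) * H (subList Tk r))
  ≡⟨ ∑-unitCandidates Lk _ ⟩
    ∑units Lk (λ r → 𝟙 (leqListᵇ r Tk) * H (subList Tk r))
  ≡⟨ cong (λ l → ∑units l (λ r → 𝟙 (leqListᵇ r Tk) * H (subList Tk r))) (length-map proj₂ Zk) ⟩
    ∑units (length Zk) (λ r → 𝟙 (leqListᵇ r (vals Zk)) * H (subList (vals Zk) r))
  ≡⟨ ∑units-lower Zk (keys-filterᵇ-unique _ Z keys-unique) H ⟩
    ∑ Zk (λ z → 𝟙 (v <ᵇ suc (proj₂ z)) * H (vals (lower (proj₁ z) v Zk)))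
  ≡⟨ ∑-cong-∈ (λ {z} z∈ → cong (𝟙 (v <ᵇ suc (proj₂ z)) *_) (H-lower z∈)) ⟩
    ∑ Zk (λ z → 𝟙 (v <ᵇ suc (proj₂ z)) * matrixProduct R (lower (proj₁ z) v Z) βs)
  ∎
  where
  open ≡-Reasoning
  open UnitRows v 0<v
  Zk = ofDegree k Z
  Tk = multiplicities Z k
  Lk = length Tk
  G : ℕ → ℕ
  G u = matrixCount (length (multiplicities Z u)) (multiplicities Z u) βs u
  H : List ℕ → ℕ
  H T = product (map (λ u → if u ≡ᵇ k then matrixCount Lk T βs k else G u) R)
  factor : ∀ u → matrixCount (length (multiplicities Z u)) (multiplicities Z u) (((k , v) ∷ []) ∷ βs) u ≡
                 (if u ≡ᵇ k then matrixCount Lk Tk (((k , v) ∷ []) ∷ βs) k else G u)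
  factor u with u ≟ k
  ... | yes refl = cong (λ b → if b then matrixCount Lk Tk (((k , v) ∷ []) ∷ βs) k else G u) (sym (≡ᵇ-refl u))
  ... | no u≢k   = trans (matrixCount-otherDegree (multiplicities Z u) k v βs u u≢k)
                         (cong (λ b → if b then matrixCount Lk Tk (((k , v) ∷ []) ∷ βs) k else G u) (sym (≡ᵇ-false u≢k)))
  H-lower : ∀ {z} → z ∈ Zk → H (vals (lower (proj₁ z) v Zk)) ≡ matrixProduct R (lower (proj₁ z) v Z) βs
  H-lower {z} z∈ with ≡ᵇ-sound {degOf z} (proj₂ (∈-filterᵇ⁻ (λ z → degOf z ≡ᵇ k) Z z∈))
  ... | refl = cong product (map-cong at R)
    where
    at : ∀ u → (if u ≡ᵇ degOf z then matrixCount Lk (vals (lower (proj₁ z) v Zk)) βs (degOf z) else G u)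
             ≡ matrixCount (length (multiplicities (lower (proj₁ z) v Z) u)) (multiplicities (lower (proj₁ z) v Z) u) βs u
    at u with u ≟ degOf z
    ... | yes refl rewrite ≡ᵇ-refl u | multiplicities-lower (proj₁ z) v Z u
                         | length-vals-lower (proj₁ z) v (ofDegree u Z) = refl
    ... | no u≢k rewrite ≡ᵇ-false u≢k | multiplicities-lower-otherDegree (degOf z) (indexOf z) v Z u u≢k = refl

matrixProduct≡factorizations : ∀ B R → Unique R → ∀ kvs Z t → Represents B t Z → All (λ z → degOf z ∈ R) Z →
  All (λ kv → proj₁ kv ∈ R × 0 < proj₂ kv) kvs → matrixProduct R Z (map (_∷ []) kvs) ≡ factorizations B kvs t
matrixProduct≡factorizations B R R-unique [] Z t rep degs∈R [] =
  trans (matrixProduct-[] R Z degs∈R) (sym (factorizations-[] rep))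
matrixProduct≡factorizations B R R-unique ((k , v) ∷ kvs) Z t rep degs∈R ((k∈R , 0<v) ∷ kvs-ok) =
  trans (matrixProduct-∷ R R-unique k v (map (_∷ []) kvs) Z k∈R 0<v (Represents.keys-unique rep))
  (trans (∑-cong-∈ (λ {z} z∈ → 𝟙-*-cong (v <ᵇ suc (proj₂ z)) (λ _ → step z∈)))
         (sym (factorizations-∷ rep k v kvs 0<v)))
  where
  step : ∀ {z} → z ∈ ofDegree k Z →
    matrixProduct R (lower (proj₁ z) v Z) (map (_∷ []) kvs) ≡ factorizations B kvs (quotient B k (indexOf z) v t)
  step {z} z∈ with ∈-filterᵇ⁻ (λ z → degOf z ≡ᵇ k) Z z∈
  ... | z∈Z , deg-z with ≡ᵇ-sound {degOf z} deg-z
  ... | refl = matrixProduct≡factorizations B R R-unique kvs _ _ (Represents-lower rep z∈Z v)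
                 (All-lower (λ p → proj₁ p ∈ R) (proj₁ z) v Z degs∈R) kvs-ok

_≽_ : Stack → Stack → Set
(d , m) ≽ (d′ , m′) = d′ < d ⊎ (d ≡ d′ × m′ ≤ m)

stack≥ᵇ-sound : ∀ a b → stack≥ᵇ a b ≡ true → a ≽ b
stack≥ᵇ-sound (d , m) (d′ , m′) h with ∨-true⁻ {d′ <ᵇ d} h
... | inj₁ d′<d = inj₁ (<ᵇ-sound d′<d)
... | inj₂ h′ with ∧-true⁻ {d ≡ᵇ d′} h′
... | d≡d′ , m′≤m = inj₂ (≡ᵇ-sound d≡d′ , ≤-pred (<ᵇ-sound m′≤m))

stack≥ᵇ-complete : ∀ a b → a ≽ b → stack≥ᵇ a b ≡ true
stack≥ᵇ-complete (d , m) (d′ , m′) (inj₁ d′<d)          rewrite <ᵇ-true d′<d = refl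
stack≥ᵇ-complete (d , m) (d′ , m′) (inj₂ (refl , m′≤m)) rewrite ≡ᵇ-refl d | <ᵇ-true (s≤s m′≤m) = ∨-zeroʳ _

≽-refl : ∀ a → a ≽ a
≽-refl (d , m) = inj₂ (refl , ≤-refl)

≽-trans : ∀ a b c → a ≽ b → b ≽ c → a ≽ c
≽-trans _ _ _ (inj₁ x)          (inj₁ y)          = inj₁ (<-trans y x)
≽-trans _ _ _ (inj₁ x)          (inj₂ (refl , _)) = inj₁ x
≽-trans _ _ _ (inj₂ (refl , _)) (inj₁ y)          = inj₁ y
≽-trans _ _ _ (inj₂ (refl , x)) (inj₂ (refl , y)) = inj₂ (refl , ≤-trans y x)

≽-antisym : ∀ a b → a ≽ b → b ≽ a → a ≡ b
≽-antisym _ _       (inj₁ x)          (inj₁ y)          = ⊥-elim (<-asym x y)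
≽-antisym _ _       (inj₁ x)          (inj₂ (refl , _)) = ⊥-elim (<-irrefl refl x)
≽-antisym _ _       (inj₂ (refl , _)) (inj₁ y)          = ⊥-elim (<-irrefl refl y)
≽-antisym (d , m) _ (inj₂ (refl , x)) (inj₂ (_ , y))    = cong (d ,_) (≤-antisym y x)

≽-total : ∀ a b → a ≽ b ⊎ b ≽ a
≽-total (d , m) (d′ , m′) with <-cmp d d′
... | tri< d<d′ _ _ = inj₂ (inj₁ d<d′)
... | tri> _ _ d′<d = inj₁ (inj₁ d′<d)
... | tri≈ _ refl _ with ≤-total m m′
...   | inj₁ m≤m′ = inj₂ (inj₂ (refl , m≤m′))
...   | inj₂ m′≤m = inj₁ (inj₂ (refl , m′≤m))

stack≥ᵇ-flip : ∀ a b → stack≥ᵇ a b ≡ false → stack≥ᵇ b a ≡ true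
stack≥ᵇ-flip a b a≱b with ≽-total a b
... | inj₁ a≽b = ⊥-elim (false≢true (trans (sym a≱b) (stack≥ᵇ-complete a b a≽b)))
... | inj₂ b≽a = stack≥ᵇ-complete b a b≽a

weaklyDecᵇ-tail : ∀ x xs → weaklyDecᵇ (x ∷ xs) ≡ true → weaklyDecᵇ xs ≡ true
weaklyDecᵇ-tail x []       h = refl
weaklyDecᵇ-tail x (y ∷ xs) h = proj₂ (∧-true⁻ {stack≥ᵇ x y} h)

weaklyDecᵇ-head : ∀ x xs → weaklyDecᵇ (x ∷ xs) ≡ true → All (x ≽_) xs
weaklyDecᵇ-head x []       h = []
weaklyDecᵇ-head x (y ∷ xs) h with ∧-true⁻ {stack≥ᵇ x y} h
... | x≥y , rest = stack≥ᵇ-sound x y x≥y ∷ All.map (≽-trans x y _ (stack≥ᵇ-sound x y x≥y)) (weaklyDecᵇ-head y xs rest)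

weaklyDecᵇ-↭⇒≡ : ∀ xs ys → weaklyDecᵇ xs ≡ true → weaklyDecᵇ ys ≡ true → xs ↭ ys → xs ≡ ys
weaklyDecᵇ-↭⇒≡ []       ys       _  _  p = sym (↭.↭-empty-inv (↭-sym p))
weaklyDecᵇ-↭⇒≡ (x ∷ xs) []       _  _  p = ↭.↭-empty-inv p
weaklyDecᵇ-↭⇒≡ (x ∷ xs) (y ∷ ys) xs↓ ys↓ p with ≽-antisym x y (greatest x xs xs↓ (↭.∈-resp-↭ (↭-sym p) (here refl)))
                                                              (greatest y ys ys↓ (↭.∈-resp-↭ p (here refl)))
  where
  greatest : ∀ z zs → weaklyDecᵇ (z ∷ zs) ≡ true → ∀ {w} → w ∈ z ∷ zs → z ≽ w
  greatest z zs h (here refl) = ≽-refl z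
  greatest z zs h (there w∈)  = All.lookup (weaklyDecᵇ-head z zs h) w∈
... | refl = cong (x ∷_) (weaklyDecᵇ-↭⇒≡ xs ys (weaklyDecᵇ-tail x xs xs↓) (weaklyDecᵇ-tail x ys ys↓) (↭.drop-∷ p))

stackOf : Factor → Stack
stackOf z = (degOf z , proj₂ z)

insertByStack : Factor → Term → Term
insertByStack z []       = z ∷ []
insertByStack z (w ∷ ws) = if stack≥ᵇ (stackOf z) (stackOf w) then z ∷ w ∷ ws else w ∷ insertByStack z ws

sortByStack : Term → Term
sortByStack []       = []
sortByStack (z ∷ zs) = insertByStack z (sortByStack zs)

insertByStack-↭ : ∀ z ws → insertByStack z ws ↭ z ∷ ws
insertByStack-↭ z []       = ↭.refl
insertByStack-↭ z (w ∷ ws) with stack≥ᵇ (stackOf z) (stackOf w)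
... | true  = ↭.refl
... | false = ↭.trans (↭.prep w (insertByStack-↭ z ws)) (↭.swap w z ↭.refl)

sortByStack-↭ : ∀ zs → sortByStack zs ↭ zs
sortByStack-↭ []       = ↭.refl
sortByStack-↭ (z ∷ zs) = ↭.trans (insertByStack-↭ z (sortByStack zs)) (↭.prep z (sortByStack-↭ zs))

insertByStack-weaklyDec : ∀ z ws → weaklyDecᵇ (map stackOf ws) ≡ true → weaklyDecᵇ (map stackOf (insertByStack z ws)) ≡ true
insertByStack-weaklyDec z []       h = refl
insertByStack-weaklyDec z (w ∷ ws) h with stack≥ᵇ (stackOf z) (stackOf w) in z≥w
... | true  rewrite z≥w = h
... | false = cons ws h (insertByStack-weaklyDec z ws (weaklyDecᵇ-tail (stackOf w) (map stackOf ws) h))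
  where
  cons : ∀ ws → weaklyDecᵇ (stackOf w ∷ map stackOf ws) ≡ true → weaklyDecᵇ (map stackOf (insertByStack z ws)) ≡ true →
         weaklyDecᵇ (stackOf w ∷ map stackOf (insertByStack z ws)) ≡ true
  cons []        _  _ rewrite stack≥ᵇ-flip (stackOf z) (stackOf w) z≥w = refl
  cons (w₂ ∷ ws) h₁ h₂ with stack≥ᵇ (stackOf z) (stackOf w₂)
  ... | true  rewrite stack≥ᵇ-flip (stackOf z) (stackOf w) z≥w = h₂
  ... | false rewrite proj₁ (∧-true⁻ {stack≥ᵇ (stackOf w) (stackOf w₂)} h₁) = h₂

sortByStack-weaklyDec : ∀ zs → weaklyDecᵇ (map stackOf (sortByStack zs)) ≡ true
sortByStack-weaklyDec []       = refl
sortByStack-weaklyDec (z ∷ zs) = insertByStack-weaklyDec z (sortByStack zs) (sortByStack-weaklyDec zs)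

support : ℕ → Exponents → Term
support B r = filterᵇ (λ z → 0 <ᵇ proj₂ z) (map (λ p → (p , r (proj₁ p) (proj₂ p))) (positions B))

module _ {B : ℕ} {r : Exponents} where

  private
    entry : ℕ × ℕ → Factor
    entry p = (p , r (proj₁ p) (proj₂ p))

  ∈-support⁻ : ∀ {z} → z ∈ support B r → proj₁ z ∈ positions B × proj₂ z ≡ r (degOf z) (indexOf z) × 0 < proj₂ z
  ∈-support⁻ z∈ with ∈-filterᵇ⁻ (λ z → 0 <ᵇ proj₂ z) (map entry (positions B)) z∈
  ... | z∈′ , 0<z with ∈-map⁻ entry z∈′
  ...   | p , p∈ , refl = p∈ , refl , <ᵇ-sound 0<z

  ∈-support⁺ : ∀ {p} → p ∈ positions B → 0 < r (proj₁ p) (proj₂ p) → entry p ∈ support B r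
  ∈-support⁺ p∈ 0<r = ∈-filterᵇ⁺ (λ z → 0 <ᵇ proj₂ z) (map entry (positions B)) (∈-map⁺ entry p∈) (<ᵇ-true 0<r)

  keys-support-unique : Unique (keys (support B r))
  keys-support-unique = keys-filterᵇ-unique _ (map entry (positions B))
                          (subst Unique (sym (keys-entries (positions B))) (positions-unique B))
    where
    keys-entries : ∀ ps → keys (map entry ps) ≡ ps
    keys-entries []       = refl
    keys-entries (p ∷ ps) = cong (p ∷_) (keys-entries ps)

  support-represents : Represents B r (support B r)
  support-represents = record
    { keys-unique = keys-support-unique
    ; inRange     = All.tabulate (λ z∈ → ∈-positions⁻ {B} (proj₁ (∈-support⁻ z∈)))
    ; exponents   = λ a b → if-then-0-cong (inRangeᵇ B a b) (exponent a b)
    }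
    where
    exponent : ∀ a b → inRangeᵇ B a b ≡ true → r a b ≡ termExp (support B r) a b
    exponent a b inRange with r a b ≟ 0
    ... | yes r≡0 = trans r≡0 (sym (termExp-∉ (support B r) a b (All.tabulate (λ {z} z∈ z≡ab →
          let _ , z≡r , 0<z = ∈-support⁻ z∈ in
          <⇒≢ 0<z (sym (trans z≡r (trans (cong (λ p → r (proj₁ p) (proj₂ p)) z≡ab) r≡0)))))))
    ... | no  r≢0 = sym (termExp-∈ (support B r) keys-support-unique (∈-support⁺ (∈-positions⁺ {B} inRange) (n≢0⇒n>0 r≢0)))

  support-positive : All (λ z → 0 < proj₂ z) (support B r)
  support-positive = All.tabulate (λ z∈ → proj₂ (proj₂ (∈-support⁻ z∈)))

termDegree : Term → ℕ
termDegree Z = ∑ Z (λ z → degOf z * proj₂ z)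

termDegree-lower : ∀ Z → Unique (keys Z) → ∀ {z} → z ∈ Z → ∀ v → v ≤ proj₂ z →
  termDegree (lower (proj₁ z) v Z) + degOf z * v ≡ termDegree Z
termDegree-lower (w ∷ Z) (w∉Z ∷ _) (here refl) v v≤w
  rewrite keyEqᵇ-refl (proj₁ w) | lower-∉ (proj₁ w) v Z (∉-keys Z w∉Z) = begin
    degOf w * (proj₂ w ∸ v) + termDegree Z + degOf w * v
  ≡⟨ +-assoc (degOf w * (proj₂ w ∸ v)) _ _ ⟩
    degOf w * (proj₂ w ∸ v) + (termDegree Z + degOf w * v)
  ≡⟨ cong (degOf w * (proj₂ w ∸ v) +_) (+-comm (termDegree Z) _) ⟩
    degOf w * (proj₂ w ∸ v) + (degOf w * v + termDegree Z)
  ≡⟨ sym (+-assoc (degOf w * (proj₂ w ∸ v)) _ _) ⟩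
    degOf w * (proj₂ w ∸ v) + degOf w * v + termDegree Z
  ≡⟨ cong (_+ termDegree Z) (trans (sym (*-distribˡ-+ (degOf w) (proj₂ w ∸ v) v)) (cong (degOf w *_) (m∸n+n≡m v≤w))) ⟩
    degOf w * proj₂ w + termDegree Z
  ∎
  where open ≡-Reasoning
termDegree-lower (w ∷ Z) (w∉Z ∷ uniq) {z} (there z∈) v v≤z
  rewrite lowerAt-elsewhere (proj₁ z) v w (All.lookup w∉Z (∈-map⁺ proj₁ z∈)) =
  trans (+-assoc (degOf w * proj₂ w) _ (degOf z * v)) (cong (degOf w * proj₂ w +_) (termDegree-lower Z uniq z∈ v v≤z))

factorizations≢0⇒termDegree : ∀ B kvs Z t → Represents B t Z → All (λ kv → 0 < proj₂ kv) kvs →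
  factorizations B kvs t ≢ 0 → termDegree Z ≡ ∑ kvs (λ kv → proj₁ kv * proj₂ kv)
factorizations≢0⇒termDegree B [] Z t rep _ ≢0 with allExponentsZeroᵇ Z in all-zero
... | true  = ∑-zero-∈ (λ {z} z∈ → trans (cong (degOf z *_) (≡ᵇ-sound (All.lookup (all-true⁻ Z all-zero) z∈))) (*-zeroʳ (degOf z)))
... | false = ⊥-elim (≢0 (trans (factorizations-[] rep) (cong 𝟙 all-zero)))
factorizations≢0⇒termDegree B ((k , v) ∷ kvs) Z t rep (0<v ∷ pos) ≢0
  with ∑≢0⇒∃ (ofDegree k Z) _ (≢0 ∘ trans (factorizations-∷ rep k v kvs 0<v))
... | z , z∈ , term≢0 with ∈-filterᵇ⁻ (λ z → degOf z ≡ᵇ k) Z z∈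
...   | z∈Z , deg-z with ≡ᵇ-sound {degOf z} deg-z | 𝟙-*≢0⁻ (v <ᵇ suc (proj₂ z)) _ term≢0
...     | refl | v≤z , rest≢0 =
  trans (sym (termDegree-lower Z (Represents.keys-unique rep) z∈Z v (≤-pred (<ᵇ-sound v≤z))))
        (trans (cong (_+ degOf z * v) (factorizations≢0⇒termDegree B kvs _ _ (Represents-lower rep z∈Z v) pos rest≢0))
               (+-comm _ (degOf z * v)))

termOf : List Stack → List ℕ → Term
termOf α js = zipWith (λ s a → ((deg s , a) , mult s)) α js

witnessᵇ : List Stack → Mono → List ℕ → Bool
witnessᵇ α μ js = distinctPerDegᵇ (zip (map deg α) js) ∧ matchesᵇ μ (termOf α js)

keys-termOf : ∀ α js → keys (termOf α js) ≡ zip (map deg α) js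
keys-termOf []      js       = refl
keys-termOf (s ∷ α) []       = refl
keys-termOf (s ∷ α) (j ∷ js) = cong ((deg s , j) ∷_) (keys-termOf α js)

multiplicities-termOf : ∀ α js → length js ≡ length α → ∀ u → multiplicities (termOf α js) u ≡ restrict α u
multiplicities-termOf []      []       _ u = refl
multiplicities-termOf (s ∷ α) (j ∷ js) e u with deg s ≡ᵇ u
... | true  = cong (mult s ∷_) (multiplicities-termOf α js (suc-injective e) u)
... | false = multiplicities-termOf α js (suc-injective e) u

All-termOf : ∀ (Q : Factor → Set) α js → All (λ s → ∀ j → Q ((deg s , j) , mult s)) α → All Q (termOf α js)
All-termOf Q []      js       []       = []
All-termOf Q (s ∷ α) []       (q ∷ qs) = []
All-termOf Q (s ∷ α) (j ∷ js) (q ∷ qs) = q j ∷ All-termOf Q α js qs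

distinctPerDegᵇ-sound : ∀ xs → distinctPerDegᵇ xs ≡ true → Unique xs
distinctPerDegᵇ-sound []             _ = []
distinctPerDegᵇ-sound ((d , a) ∷ xs) h with ∧-true⁻ {all (λ y → not ((d ≡ᵇ proj₁ y) ∧ (a ≡ᵇ proj₂ y))) xs} h
... | fresh , rest = All.map distinct (all-true⁻ xs fresh) ∷ distinctPerDegᵇ-sound xs rest
  where
  distinct : ∀ {y} → not (keyEqᵇ (d , a) y) ≡ true → (d , a) ≢ y
  distinct {y} h refl rewrite keyEqᵇ-refl y = false≢true h

distinctPerDegᵇ-complete : ∀ xs → Unique xs → distinctPerDegᵇ xs ≡ true
distinctPerDegᵇ-complete []             _               = refl
distinctPerDegᵇ-complete ((d , a) ∷ xs) (fresh ∷ uniq)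
  rewrite all-true⁺ {p = λ y → not ((d ≡ᵇ proj₁ y) ∧ (a ≡ᵇ proj₂ y))} (All.map (λ ne → cong not (keyEqᵇ-false ne)) fresh) =
  distinctPerDegᵇ-complete xs uniq

M≡1⇒witness : ∀ α B r → M α (mono B r) ≡ 1 →
  ∃ λ js → js ∈ choices (replicate (length α) (from1 B)) × witnessᵇ α (mono B r) js ≡ true
M≡1⇒witness α B r h with any (witnessᵇ α (mono B r)) (choices (replicate (length α) (from1 B))) in found
... | true = find (any-true⁻ (choices (replicate (length α) (from1 B))) found)

witness⇒Represents : ∀ α js B r → witnessᵇ α (mono B r) js ≡ true → Represents B r (termOf α js)
witness⇒Represents α js B r h with ∧-true⁻ {distinctPerDegᵇ (zip (map deg α) js)} h
... | distinct , matches with ∧-true⁻ {all (λ z → inRangeᵇ B (degOf z) (indexOf z)) (termOf α js)} matches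
... | inRange , exponents = record
  { keys-unique = subst Unique (sym (keys-termOf α js)) (distinctPerDegᵇ-sound _ distinct)
  ; inRange     = all-true⁻ (termOf α js) inRange
  ; exponents   = λ a b → if-then-0-cong (inRangeᵇ B a b) (λ ab∈ →
      trans (sym (expo-inRange B r ab∈))
            (≡ᵇ-sound (All.lookup (all-true⁻ (positions B) exponents) (∈-positions⁺ {B} {a} {b} ab∈))))
  }

-- 𝒟 as a coefficient of P

Dseq≡divisorStacks : ∀ τ ks → Dseq τ ks ≡ map (_∷ []) (divisorStacks τ ks)
Dseq≡divisorStacks []      ks        = refl
Dseq≡divisorStacks (s ∷ τ) []        = refl
Dseq≡divisorStacks (s ∷ τ) (kq ∷ ks) = cong (((proj₁ kq , proj₂ kq * mult s) ∷ []) ∷_) (Dseq≡divisorStacks τ ks)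

divisorStacks-sound : ∀ τ ks → PositiveStacks τ → ks ∈ divisorChoices τ →
  All (λ kv → 0 < proj₁ kv × 0 < proj₂ kv) (divisorStacks τ ks) × ∑ (divisorStacks τ ks) (λ kv → proj₁ kv * proj₂ kv) ≡ size τ
divisorStacks-sound []            .[] []                 (here refl) = [] , refl
divisorStacks-sound ((d , m) ∷ τ) ks  ((0<d , 0<m) ∷ pos) ks∈
  with ∈-choices⁻ (divisorPairs d) (map (λ s → divisorPairs (deg s)) τ) ks∈
... | (k , q) , ks′ , refl , kq∈ , ks′∈
  with divisorStacks-sound τ ks′ pos ks′∈ | All.lookup (divisorPairs-sound d) kq∈ | All.lookup (divisorPairs-quotient-pos d 0<d) kq∈
... | positive , total | 0<k , kq≡d | 0<q =
  ((0<k , *-mono-< 0<q 0<m) ∷ positive) , cong₂ _+_ (trans (sym (*-assoc k q m)) (cong (_* m) kq≡d)) total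

𝒮≡factorizations : ∀ τ α ks js B r → PositiveStacks τ → PositiveStacks α → ks ∈ divisorChoices τ →
  length js ≡ length α → Represents B r (termOf α js) → 𝒮 α (Dseq τ ks) ≡ factorizations B (divisorStacks τ ks) r
𝒮≡factorizations τ α ks js B r τ-pos α-pos ks∈ |js|≡|α| rep =
  trans (cong product (map-cong (λ u → cong₂ (λ T βs → matrixCount (length T) T βs u)
                                              (sym (multiplicities-termOf α js |js|≡|α| u)) (Dseq≡divisorStacks τ ks)) R))
        (matrixProduct≡factorizations B R (from1-unique (suc N)) kvs (termOf α js) r rep degs∈R kvs-ok)
  where
  kvs = divisorStacks τ ks
  N = sum (map deg α) + sum (map (λ β → sum (map deg β)) (Dseq τ ks))
  R = from1 (suc N)
  degs∈R : All (λ z → degOf z ∈ R) (termOf α js)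
  degs∈R = All-termOf (λ z → degOf z ∈ R) α js (All.tabulate (λ {s} s∈ _ →
    ∈-from1⁺ (proj₁ (All.lookup α-pos s∈)) (s≤s (≤-trans (∈⇒≤sum (map deg α) (∈-map⁺ deg s∈)) (m≤m+n _ _)))))
  k≤N : ∀ {kv} → kv ∈ kvs → proj₁ kv ≤ N
  k≤N {kv} kv∈ = ≤-trans (≤-reflexive (sym (+-identityʳ (proj₁ kv))))
    (≤-trans (∈⇒≤sum _ (subst (λ βs → proj₁ kv + 0 ∈ map (λ β → sum (map deg β)) βs) (sym (Dseq≡divisorStacks τ ks))
                              (∈-map⁺ (λ β → sum (map deg β)) (∈-map⁺ (_∷ []) kv∈))))
             (m≤n+m _ _))
  kvs-ok : All (λ kv → proj₁ kv ∈ R × 0 < proj₂ kv) kvs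
  kvs-ok = All.tabulate (λ {kv} kv∈ → let 0<k , 0<v = All.lookup (proj₁ (divisorStacks-sound τ ks τ-pos ks∈)) kv∈
                                       in ∈-from1⁺ 0<k (s≤s (k≤N kv∈)) , 0<v)

M≡1⇒𝒟≡P : ∀ τ α B r → PositiveStacks τ → PositiveStacks α → M α (mono B r) ≡ 1 → 𝒟 τ α ≡ P τ (mono B r)
M≡1⇒𝒟≡P τ α B r τ-pos α-pos M≡1 with M≡1⇒witness α B r M≡1
... | js , js∈ , witness =
  sym (trans (P-factorizations τ τ-pos B r)
             (∑-cong-∈ (λ {ks} ks∈ → cong (product (map proj₁ ks) *_)
               (sym (𝒮≡factorizations τ α ks js B r τ-pos α-pos ks∈ (length-∈-choices-replicate (length α) (from1 B) js∈)
                                        (witness⇒Represents α js B r witness))))))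

eqStacksᵇ : List Stack → List Stack → Bool
eqStacksᵇ []       []       = true
eqStacksᵇ (x ∷ xs) (y ∷ ys) = keyEqᵇ x y ∧ eqStacksᵇ xs ys
eqStacksᵇ _        _        = false

eqStacksᵇ-sound : ∀ {xs ys} → eqStacksᵇ xs ys ≡ true → xs ≡ ys
eqStacksᵇ-sound {[]}     {[]}     _ = refl
eqStacksᵇ-sound {x ∷ xs} {y ∷ ys} h with ∧-true⁻ {keyEqᵇ x y} h
... | x≡y , xs≡ys = cong₂ _∷_ (keyEqᵇ-sound x≡y) (eqStacksᵇ-sound xs≡ys)

eqStacksᵇ-refl : ∀ xs → eqStacksᵇ xs xs ≡ true
eqStacksᵇ-refl []       = refl
eqStacksᵇ-refl (x ∷ xs) rewrite keyEqᵇ-refl x = eqStacksᵇ-refl xs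

∑-choices-replicate-δ : ∀ (X : List Stack) → Unique X → ∀ ℓ xs → All (_∈ X) xs →
  ∑ (choices (replicate ℓ X)) (λ α → 𝟙 (eqStacksᵇ α xs)) ≡ 𝟙 (ℓ ≡ᵇ length xs)
∑-choices-replicate-δ X uniq zero    []       _ = refl
∑-choices-replicate-δ X uniq zero    (x ∷ xs) _ = refl
∑-choices-replicate-δ X uniq (suc ℓ) []       _ =
  trans (∑-choices X (replicate ℓ X) _) (∑-zero (λ y → ∑-zero (λ ys → refl) (choices (replicate ℓ X))) X)
∑-choices-replicate-δ X uniq (suc ℓ) (x ∷ xs) (x∈ ∷ xs⊆) =
  trans (∑-choices X (replicate ℓ X) _)
  (trans (∑-cong (λ y → trans (∑-cong (λ ys → 𝟙-∧ (keyEqᵇ y x) (eqStacksᵇ ys xs)) (choices (replicate ℓ X)))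
                       (trans (∑-*ˡ (𝟙 (keyEqᵇ y x)) (choices (replicate ℓ X)) (λ ys → 𝟙 (eqStacksᵇ ys xs)))
                              (cong (𝟙 (keyEqᵇ y x) *_) (∑-choices-replicate-δ X uniq ℓ xs xs⊆)))) X)
         (∑-δ keyEqᵇ keyEqᵇ-sound keyEqᵇ-refl x∈ uniq (λ _ → 𝟙 (ℓ ≡ᵇ length xs))))

isStackPartitionᵇ⁻ : ∀ n α → isStackPartitionᵇ n α ≡ true → PositiveStacks α × weaklyDecᵇ α ≡ true × size α ≡ n
isStackPartitionᵇ⁻ n α h with ∧-true⁻ {all positiveᵇ α} h
... | positive , h′ with ∧-true⁻ {weaklyDecᵇ α} h′
... | decreasing , sized = All.map pos (all-true⁻ α positive) , decreasing , ≡ᵇ-sound sized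
  where
  pos : ∀ {s} → positiveᵇ s ≡ true → 0 < deg s × 0 < mult s
  pos {d , m} h with ∧-true⁻ {0 <ᵇ d} h
  ... | 0<d , 0<m = <ᵇ-sound 0<d , <ᵇ-sound 0<m

∈-stackPartitions⁻ : ∀ n {α} → α ∈ stackPartitions n → isStackPartitionᵇ n α ≡ true
∈-stackPartitions⁻ n α∈ =
  proj₂ (∈-filterᵇ⁻ (isStackPartitionᵇ n) (concatMap (λ ℓ → choices (replicate ℓ (positions (suc n)))) (upTo (suc n))) α∈)

stackPartition-bounds : ∀ n α → isStackPartitionᵇ n α ≡ true → All (_∈ positions (suc n)) α × length α ≤ n
stackPartition-bounds n α α⊩n = stacks∈ , subst (length α ≤_) |α|≡n (length≤size α α-pos)
  where
  α-pos = proj₁ (isStackPartitionᵇ⁻ n α α⊩n)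
  |α|≡n = proj₂ (proj₂ (isStackPartitionᵇ⁻ n α α⊩n))
  dm≤n : ∀ {s} → s ∈ α → deg s * mult s ≤ n
  dm≤n s∈ = subst (_ ≤_) |α|≡n (∈⇒≤sum (map (λ s → deg s * mult s) α) (∈-map⁺ (λ s → deg s * mult s) s∈))
  stacks∈ : All (_∈ positions (suc n)) α
  stacks∈ = All.tabulate (λ {s} s∈ → let 0<d , 0<m = All.lookup α-pos s∈ in
    ∈-positions⁺ {suc n} (inRangeᵇ⁺ {suc n} (∈-from1⁺ 0<d (s≤s (≤-trans (m≤m*n (deg s) (mult s) ⦃ >-nonZero 0<m ⦄) (dm≤n s∈))))
                                             (∈-from1⁺ 0<m (s≤s (≤-trans (m≤n*m (mult s) (deg s) ⦃ >-nonZero 0<d ⦄) (dm≤n s∈))))))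
  length≤size : ∀ xs → PositiveStacks xs → length xs ≤ size xs
  length≤size []       []                   = z≤n
  length≤size (s ∷ xs) ((0<d , 0<m) ∷ rest) = +-mono-≤ (*-mono-≤ 0<d 0<m) (length≤size xs rest)

-- the stacks offered by stackPartitions n are exactly the pairs in positions (suc n)
∑-stackPartitions-δ : ∀ n α → isStackPartitionᵇ n α ≡ true → ∑ (stackPartitions n) (λ β → 𝟙 (eqStacksᵇ β α)) ≡ 1
∑-stackPartitions-δ n α α⊩n =
  begin
    ∑ (stackPartitions n) (λ β → 𝟙 (eqStacksᵇ β α))
  ≡⟨ ∑-filter (isStackPartitionᵇ n) L _ ⟩
    ∑ L (λ β → 𝟙 (isStackPartitionᵇ n β) * 𝟙 (eqStacksᵇ β α))
  ≡⟨ ∑-cong drop-filter L ⟩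
    ∑ L (λ β → 𝟙 (eqStacksᵇ β α))
  ≡⟨ ∑-concatMap (λ ℓ → choices (replicate ℓ (positions (suc n)))) (upTo (suc n)) _ ⟩
    ∑ (upTo (suc n)) (λ ℓ → ∑ (choices (replicate ℓ (positions (suc n)))) (λ β → 𝟙 (eqStacksᵇ β α)))
  ≡⟨ ∑-cong (λ ℓ → trans (∑-choices-replicate-δ (positions (suc n)) (positions-unique (suc n)) ℓ α stacks∈)
                          (sym (*-identityʳ _))) (upTo (suc n)) ⟩
    ∑ (upTo (suc n)) (λ ℓ → 𝟙 (ℓ ≡ᵇ length α) * 1)
  ≡⟨ ∑-δ-upTo (suc n) (length α) (λ _ → 1) ⟩
    𝟙 (length α <ᵇ suc n) * 1
  ≡⟨ cong (λ b → 𝟙 b * 1) (<ᵇ-true (s≤s |α|≤n)) ⟩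
    1
  ∎
  where
  open ≡-Reasoning
  L = concatMap (λ ℓ → choices (replicate ℓ (positions (suc n)))) (upTo (suc n))
  stacks∈ = proj₁ (stackPartition-bounds n α α⊩n)
  |α|≤n   = proj₂ (stackPartition-bounds n α α⊩n)
  drop-filter : ∀ β → 𝟙 (isStackPartitionᵇ n β) * 𝟙 (eqStacksᵇ β α) ≡ 𝟙 (eqStacksᵇ β α)
  drop-filter β with eqStacksᵇ β α in β≡α
  ... | true  rewrite eqStacksᵇ-sound {β} β≡α | α⊩n = refl
  ... | false = *-zeroʳ (𝟙 (isStackPartitionᵇ n β))

-- The shape of a monomial

shapeTerm : ℕ → Exponents → Term
shapeTerm B r = sortByStack (support B r)

-- the unique stack partition α with x^r a monomial of M_α
shape : ℕ → Exponents → List Stack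
shape B r = map stackOf (shapeTerm B r)

map-stackOf-termOf : ∀ α js → length js ≡ length α → map stackOf (termOf α js) ≡ α
map-stackOf-termOf []      []       _ = refl
map-stackOf-termOf (s ∷ α) (j ∷ js) e = cong (s ∷_) (map-stackOf-termOf α js (suc-injective e))

M-cases : ∀ α μ → M α μ ≡ 0 ⊎ M α μ ≡ 1
M-cases α μ with any (witnessᵇ α μ) (choices (replicate (length α) (from1 (Mono.bound μ))))
... | true  = inj₂ refl
... | false = inj₁ refl

module _ {B : ℕ} {r : Exponents} where

  private
    Zs = shapeTerm B r
    js = map indexOf Zs
    module ↭ₛ = Data.List.Relation.Binary.Permutation.Setoid.Properties (setoid (ℕ × ℕ))

  shapeTerm-↭ : Zs ↭ support B r
  shapeTerm-↭ = sortByStack-↭ (support B r)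

  shapeTerm-represents : Represents B r Zs
  shapeTerm-represents = record
    { keys-unique = ↭ₛ.Unique-resp-↭ (↭.↭⇒↭ₛ (↭.map⁺ proj₁ (↭-sym shapeTerm-↭))) keys-unique
    ; inRange     = ↭.All-resp-↭ (↭-sym shapeTerm-↭) inRange
    ; exponents   = λ a b → trans (exponents a b) (if-then-0-cong (inRangeᵇ B a b) (λ _ →
        sum-↭ (↭.map⁺ (λ z → if keyEqᵇ (proj₁ z) (a , b) then proj₂ z else 0) (↭-sym shapeTerm-↭))))
    }
    where open Represents (support-represents {B} {r})

  termOf-shape : termOf (shape B r) js ≡ Zs
  termOf-shape = go Zs
    where
    go : ∀ W → termOf (map stackOf W) (map indexOf W) ≡ W
    go []      = refl
    go (w ∷ W) = cong (w ∷_) (go W)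

  size-shape : size (shape B r) ≡ termDegree (support B r)
  size-shape = trans (∑-map stackOf Zs (λ s → deg s * mult s)) (sum-↭ (↭.map⁺ (λ z → degOf z * proj₂ z) shapeTerm-↭))

  positiveᵇ-stackOf : ∀ {z} → InRange B z → 0 < proj₂ z → positiveᵇ (stackOf z) ≡ true
  positiveᵇ-stackOf {z} inRange 0<m
    rewrite <ᵇ-true (proj₁ (∈-from1⁻ {B} (proj₁ (inRangeᵇ⁻ {B} {degOf z} inRange)))) | <ᵇ-true 0<m = refl

  shape-⊩ : ∀ n → termDegree (support B r) ≡ n → isStackPartitionᵇ n (shape B r) ≡ true
  shape-⊩ n degree
    rewrite all-true⁺ {p = positiveᵇ} {xs = shape B r}
              (All.map⁺ (All.zipWith (λ {z} (inRange , 0<m) → positiveᵇ-stackOf {z} inRange 0<m)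
                                     (Represents.inRange shapeTerm-represents , ↭.All-resp-↭ (↭-sym shapeTerm-↭) (support-positive {B} {r}))))
          | sortByStack-weaklyDec (support B r) | trans size-shape degree | ≡ᵇ-refl n = refl

  M-shape≡1 : M (shape B r) (mono B r) ≡ 1
  M-shape≡1 = cong 𝟙 (any-true⁺ js∈ witness)
    where
    open Represents shapeTerm-represents
    js∈ : js ∈ choices (replicate (length (shape B r)) (from1 B))
    js∈ = subst (λ l → js ∈ choices (replicate l (from1 B))) (trans (length-map indexOf Zs) (sym (length-map stackOf Zs)))
            (∈-choices-replicate (from1 B) js (All.map⁺ (All.map (λ {z} ir → proj₂ (inRangeᵇ⁻ {B} {degOf z} ir)) inRange)))
    zip-shape : ∀ W → zip (map deg (map stackOf W)) (map indexOf W) ≡ keys W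
    zip-shape []      = refl
    zip-shape (w ∷ W) = cong (proj₁ w ∷_) (zip-shape W)
    witness : witnessᵇ (shape B r) (mono B r) js ≡ true
    witness rewrite zip-shape Zs | termOf-shape | distinctPerDegᵇ-complete (keys Zs) keys-unique | all-true⁺ {xs = Zs} inRange =
      all-true⁺ {xs = positions B} (All.tabulate (λ {p} p∈ →
        subst (λ x → (expo (mono B r) (proj₁ p) (proj₂ p) ≡ᵇ x) ≡ true) (expo≡termExp (∈-positions⁻ {B} p∈))
              (≡ᵇ-refl (expo (mono B r) (proj₁ p) (proj₂ p)))))

  M≡1⇒≡shape : ∀ α → PositiveStacks α → weaklyDecᵇ α ≡ true → M α (mono B r) ≡ 1 → α ≡ shape B r
  M≡1⇒≡shape α α-pos α↓ M≡1 with M≡1⇒witness α B r M≡1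
  ... | js′ , js′∈ , witness = weaklyDecᵇ-↭⇒≡ α (shape B r) α↓ (sortByStack-weaklyDec (support B r)) α↭shape
    where
    Zα = termOf α js′
    rep = witness⇒Represents α js′ B r witness
    open Represents rep
    |js′|≡|α| = length-∈-choices-replicate (length α) (from1 B) js′∈
    value : ∀ {z} → z ∈ Zα → proj₂ z ≡ r (degOf z) (indexOf z)
    value {z} z∈ = trans (sym (expo≡proj₂ z∈)) (expo-inRange B r (All.lookup inRange z∈))
    positive : All (λ z → 0 < proj₂ z) Zα
    positive = All-termOf (λ z → 0 < proj₂ z) α js′ (All.map (λ p _ → proj₂ p) α-pos)
    Zα⊆support : ∀ {z} → z ∈ Zα → z ∈ support B r
    Zα⊆support {z} z∈ = subst (_∈ support B r) (cong (proj₁ z ,_) (sym (value z∈)))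
      (∈-support⁺ {B} {r} (∈-positions⁺ {B} (All.lookup inRange z∈)) (subst (0 <_) (value z∈) (All.lookup positive z∈)))
    termExp≡r : ∀ {a b} → (a , b) ∈ positions B → termExp Zα a b ≡ r a b
    termExp≡r ab∈ = trans (sym (expo≡termExp (∈-positions⁻ {B} ab∈))) (expo-∈-positions B r ab∈)
    support⊆Zα : ∀ {z} → z ∈ support B r → z ∈ Zα
    support⊆Zα {z} z∈ with ∈-support⁻ {B} {r} z∈
    ... | p∈ , z≡r , 0<z with find (termExp≢0⇒∈ Zα (degOf z) (indexOf z) (λ e → <⇒≢ 0<z (sym (trans z≡r (trans (sym (termExp≡r p∈)) e)))))
    ... | z′ , z′∈ , key≡ =
      subst (_∈ Zα) (cong₂ _,_ key≡ (trans (value z′∈) (trans (cong (λ q → r (proj₁ q) (proj₂ q)) key≡) (sym z≡r)))) z′∈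
    α↭shape : α ↭ shape B r
    α↭shape = subst (_↭ shape B r) (map-stackOf-termOf α js′ |js′|≡|α|)
      (↭-trans (↭.map⁺ stackOf (unique-same-elements⇒↭ (keys-unique⇒unique Zα keys-unique)
                                                       (keys-unique⇒unique (support B r) (keys-support-unique {B} {r}))
                                                       Zα⊆support support⊆Zα))
               (↭.map⁺ stackOf (↭-sym shapeTerm-↭)))

-- Comparing coefficients

P≢0⇒termDegree : ∀ n τ B r → isStackPartitionᵇ n τ ≡ true → P τ (mono B r) ≢ 0 → termDegree (support B r) ≡ n
P≢0⇒termDegree n τ B r τ⊩n P≢0
  with ∑≢0⇒∃ (divisorChoices τ) _ (P≢0 ∘ trans (P-factorizations τ τ-pos B r))
  where τ-pos = proj₁ (isStackPartitionᵇ⁻ n τ τ⊩n)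
... | ks , ks∈ , term≢0 =
  trans (factorizations≢0⇒termDegree B (divisorStacks τ ks) (support B r) r (support-represents {B} {r})
           (All.map proj₂ (proj₁ sound))
           (term≢0 ∘ λ e → trans (cong (product (map proj₁ ks) *_) e) (*-zeroʳ (product (map proj₁ ks)))))
        (trans (proj₂ sound) (proj₂ (proj₂ (isStackPartitionᵇ⁻ n τ τ⊩n))))
  where sound = divisorStacks-sound τ ks (proj₁ (isStackPartitionᵇ⁻ n τ τ⊩n)) ks∈

∑-M≡1 : ∀ n B r → termDegree (support B r) ≡ n → ∑ (stackPartitions n) (λ α → M α (mono B r)) ≡ 1
∑-M≡1 n B r degree =
  trans (∑-cong-∈ (λ {α} α∈ → M≡𝟙 α (∈-stackPartitions⁻ n α∈)))
        (∑-stackPartitions-δ n (shape B r) (shape-⊩ {B} {r} n degree))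
  where
  M≡𝟙 : ∀ α → isStackPartitionᵇ n α ≡ true → M α (mono B r) ≡ 𝟙 (eqStacksᵇ α (shape B r))
  M≡𝟙 α α⊩n with eqStacksᵇ α (shape B r) in α≡shape | M-cases α (mono B r)
  ... | true  | _      rewrite eqStacksᵇ-sound {α} α≡shape = M-shape≡1 {B} {r}
  ... | false | inj₁ M≡0 = M≡0
  ... | false | inj₂ M≡1 = ⊥-elim (false≢true (trans (sym α≡shape)
                           (subst (λ β → eqStacksᵇ β (shape B r) ≡ true)
                                  (sym (M≡1⇒≡shape {B} {r} α (proj₁ α-props) (proj₁ (proj₂ α-props)) M≡1))
                                  (eqStacksᵇ-refl (shape B r)))))
    where α-props = isStackPartitionᵇ⁻ n α α⊩n

𝒟M≡PM : ∀ n τ B r α → isStackPartitionᵇ n τ ≡ true → isStackPartitionᵇ n α ≡ true →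
  𝒟 τ α * M α (mono B r) ≡ P τ (mono B r) * M α (mono B r)
𝒟M≡PM n τ B r α τ⊩n α⊩n with M-cases α (mono B r)
... | inj₁ M≡0 rewrite M≡0 = trans (*-zeroʳ (𝒟 τ α)) (sym (*-zeroʳ (P τ (mono B r))))
... | inj₂ M≡1 = cong (_* M α (mono B r))
  (M≡1⇒𝒟≡P τ α B r (proj₁ (isStackPartitionᵇ⁻ n τ τ⊩n)) (proj₁ (isStackPartitionᵇ⁻ n α α⊩n)) M≡1)

*-identity-unless-0 : ∀ x s → (x ≢ 0 → s ≡ 1) → x * s ≡ x
*-identity-unless-0 zero    s h = refl
*-identity-unless-0 (suc x) s h rewrite h (λ ()) = *-identityʳ (suc x)

mainTheorem16 : (n : ℕ) (τ : List Stack) → τ ⊩ n →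
    P τ ≈ sumS (map (λ α → scale (𝒟 τ α) (M α)) (stackPartitions n))
mainTheorem16 n τ τ⊩n μ@(mono B r) = sym (begin
    sumS (map (λ α → scale (𝒟 τ α) (M α)) (stackPartitions n)) μ
  ≡⟨ sumS-coefficient (λ α → scale (𝒟 τ α) (M α)) (stackPartitions n) μ ⟩
    ∑ (stackPartitions n) (λ α → 𝒟 τ α * M α μ)
  ≡⟨ ∑-cong-∈ (λ {α} α∈ → 𝒟M≡PM n τ B r α (T⇒≡true τ⊩n) (∈-stackPartitions⁻ n α∈)) ⟩
    ∑ (stackPartitions n) (λ α → P τ μ * M α μ)
  ≡⟨ ∑-*ˡ (P τ μ) (stackPartitions n) (λ α → M α μ) ⟩
    P τ μ * ∑ (stackPartitions n) (λ α → M α μ)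
  ≡⟨ *-identity-unless-0 (P τ μ) _ (∑-M≡1 n B r ∘ P≢0⇒termDegree n τ B r (T⇒≡true τ⊩n)) ⟩
    P τ μ
  ∎)
  where open ≡-Reasoning
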